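{- Let $q$ be an odd prime power with $q\equiv 1\pmod 4$. Then (i) the Paley graph $P(q)$ belongs to $\mathfrak{Gr}(q,(q+3)/2)$; (ii) for every $i=0,1,\dots,q+1$ there exists a graph in $\mathfrak{Gr}(q+i,(q+3)/2+i)$.
   Context: All graphs are finite, simple and undirected. For a prime power $q\equiv1\pmod 4$, the Paley graph $P(q)$ has as vertex set the finite field $F_q$, with distinct $i,j$ adjacent if and only if $i-j$ is a nonzero square in $F_q$. For a graph $G=(V,E)$ and $x\in V$, $N[x]=\{x\}\cup\{y: xy\in E\}$. A set $C\subseteq V$ is identifying if $N[x]\cap C\ne\emptyset$ for every $x\in V$ and $N[x]\cap C\neq N[y]\cap C$ for all distinct $x,y\in V$. For $n\ge k\ge1$, $\mathfrak{Gr}(n,k)$ is the set of graphs on $n$ vertices in which every $k$-element subset of vertices is identifying. -}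

module Defs where

open import Level using (0ℓ)
open import Data.Nat using (ℕ; _+_)
open import Data.Fin using (Fin)
open import Data.Fin.Subset using (Subset; _∈_; ∣_∣)
open import Data.Product using (Σ; ∃; _×_; _,_)
open import Data.Sum using (_⊎_)
open import Relation.Nullary using (¬_)
open import Relation.Binary.PropositionalEquality using (_≡_; _≢_)
open import Function.Bundles using (_↔_; _⇔_; Inverse)
open import Algebra.Structures using (IsCommutativeRing)

IsSimple : ∀ {n} → (Fin n → Fin n → Set) → Set
IsSimple {n} A = (∀ {x y} → A x y → A y x) × (∀ {x} → ¬ A x x)

record Graph (n : ℕ) : Set₁ where
  field
    Adj    : Fin n → Fin n → Set
    simple : IsSimple Adj

_∈N[_]_ : ∀ {n} → Fin n → Fin n → (Fin n → Fin n → Set) → Set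
y ∈N[ x ] A = (y ≡ x) ⊎ A x y

Identifying : ∀ {n} → (Fin n → Fin n → Set) → Subset n → Set
Identifying {n} G C =
  (∀ x → ∃ λ y → y ∈ C × y ∈N[ x ] G)
  × (∀ x y → x ≢ y →
       ¬ (∀ z → (z ∈ C × z ∈N[ x ] G) ⇔ (z ∈ C × z ∈N[ y ] G)))

InGrAdj : (n k : ℕ) → (Fin n → Fin n → Set) → Set
InGrAdj n k A = ∀ (C : Subset n) → ∣ C ∣ ≡ k → Identifying A C

InGr : (n k : ℕ) → Graph n → Set
InGr n k G = InGrAdj n k (Graph.Adj G)

record FiniteField (q : ℕ) : Set₁ where
  field
    Carrier : Set
    _+F_ _*F_ : Carrier → Carrier → Carrier
    -F_ : Carrier → Carrier
    0F 1F : Carrier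
    isCommutativeRing : IsCommutativeRing _≡_ _+F_ _*F_ -F_ 0F 1F
    0≢1 : 0F ≢ 1F
    inverse : ∀ x → x ≢ 0F → ∃ λ y → x *F y ≡ 1F
    enum : Fin q ↔ Carrier

  _-F_ : Carrier → Carrier → Carrier
  x -F y = x +F (-F y)

  IsNonzeroSquare : Carrier → Set
  IsNonzeroSquare d = d ≢ 0F × ∃ λ a → a *F a ≡ d

-- It is a simple graph exactly when
-- -1 is a square; the theorem asserts simplicity together with membership.

PaleyAdj : ∀ {q} (F : FiniteField q) → Fin q → Fin q → Set
PaleyAdj F i j = IsNonzeroSquare (to i -F to j)
  where open FiniteField F
        open Inverse enum using (to)

-- Write q = 4m + 1. If every closed neighbourhood N[x] and every symmetric difference
-- N[x] Δ N[y] (x ≠ y) has at least 2m vertices, then every set C with |C| + 2m > n meets all of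
-- them, i.e. C is identifying; |C| = (q + 3) / 2 + i gives |C| + 2m = q + i + 1.
-- In P(q) these sets are counted through the pair (χ (u - z), χ (v - z)) of values of the
-- quadratic character χ. The substitution z = v + (u - v) w reduces the count to the cyclotomic
-- numbers #{w : χ (w - 1) = α, χ w = β}, which equal m for nonzero (α, β) ≠ (1, 1), because χ is
-- multiplicative and χ (-1) = 1.
-- For (ii) the i new vertices are pairwise non-adjacent: copies of Paley vertices u adjacent to u
-- and to the non-neighbours of u, and, for i = q + 1, an apex adjacent to all of P(q). Their closed
-- neighbourhoods, traced on P(q), satisfy the same two bounds.

module Submission where

open import Defs
open import Data.Nat using (ℕ; suc; _+_; _*_; _≤_; _/_; _%_)
open import Data.Nat.DivMod using (m≡m%n+[m/n]*n; m*n/n≡m)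
open import Data.Nat.Tactic.RingSolver using (solve-∀)
open import Data.Product using (_×_; _,_; Σ)
open import Relation.Binary.PropositionalEquality using (_≡_; sym; trans; cong; subst)

module Counting where

  open import Data.Bool using (Bool; true; false; _∧_; _∨_; not)
  open import Data.Bool.Properties using (¬-not; ∧-identityʳ; ∧-zeroʳ; ∧-inverseʳ; ∨-inverseʳ)
  open import Data.Nat using (ℕ; zero; suc; _+_; _*_; _≤_; _<_; z≤n)
  open import Data.Nat.Properties
    using (+-0-commutativeMonoid; +-assoc; +-identityʳ; m+n≡0⇒n≡0; +-monoʳ-≤; +-cancelʳ-<; <-≤-trans; m≤m+n; >⇒≢;
           module ≤-Reasoning)
  open import Data.Fin using (Fin; zero; suc; _↑ˡ_)
  open import Data.Fin.Properties using (_≟_; _<?_; <-cmp; any?; suc-injective)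
  open import Data.Fin.Permutation using (Permutation′; permutation; _⟨$⟩ʳ_)
  open import Data.Product using (∃; _×_; _,_; map₂)
  open import Relation.Binary.Definitions using (tri<; tri≈; tri>)
  open import Relation.Binary.PropositionalEquality
  open import Relation.Nullary using (Dec; does; yes; no; contradiction)
  open import Relation.Nullary.Decidable using (dec-true; dec-false)
  open import Algebra.Properties.CommutativeMonoid.Sum +-0-commutativeMonoid
    using (sum; sum-syntax; ∑-distrib-+; ∑-comm; ∑-permute; sum-cong-≗; sum-replicate-zero)

  dec-witness : ∀ {a} {A : Set a} (a? : Dec A) → does a? ≡ true → A
  dec-witness (yes a) _ = a

  bit : Bool → ℕ
  bit true = 1
  bit false = 0

  count : ∀ {n} → (Fin n → Bool) → ℕ
  count p = sum (λ i → bit (p i))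

  count-cong : ∀ {n} {p r : Fin n → Bool} → (∀ i → p i ≡ r i) → count p ≡ count r
  count-cong e = sum-cong-≗ (λ i → cong bit (e i))

  count-false : ∀ {n} → count {n} (λ _ → false) ≡ 0
  count-false {n} = sum-replicate-zero n

  count-none : ∀ {n} {p : Fin n → Bool} → (∀ i → p i ≡ false) → count p ≡ 0
  count-none {n} e = trans (count-cong e) (count-false {n})

  count-pointwise : ∀ {n} (p r s : Fin n → Bool) → (∀ i → bit (p i) ≡ bit (r i) + bit (s i)) →
    count p ≡ count r + count s
  count-pointwise p r s e = trans (sum-cong-≗ e) (∑-distrib-+ (λ i → bit (r i)) (λ i → bit (s i)))

  count-split : ∀ {n} (p r : Fin n → Bool) →
    count p ≡ count (λ i → p i ∧ r i) + count (λ i → p i ∧ not (r i))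
  count-split p r = count-pointwise _ _ _ (λ i → split (p i) (r i))
    where
    split : ∀ a b → bit a ≡ bit (a ∧ b) + bit (a ∧ not b)
    split true true = refl
    split true false = refl
    split false _ = refl

  count-∨ : ∀ {n} (p r : Fin n → Bool) → (∀ i → p i ∧ r i ≡ false) →
    count (λ i → p i ∨ r i) ≡ count p + count r
  count-∨ p r disjoint = count-pointwise _ _ _ (λ i → union (p i) (r i) (disjoint i))
    where
    union : ∀ a b → a ∧ b ≡ false → bit (a ∨ b) ≡ bit a + bit b
    union true false _ = refl
    union false _ _ = refl

  count-witness : ∀ {n} (p : Fin n → Bool) → 0 < count p → ∃ λ i → p i ≡ true
  count-witness p pos with any? (λ i → p i Data.Bool.≟ true)
  ... | yes witness = witness
  ... | no none = contradiction (count-none (λ i → ¬-not (λ pi → none (i , pi)))) (>⇒≢ pos)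

  count-single : ∀ {n} (p : Fin n → Bool) (c : Fin n) → p c ≡ true → (∀ i → p i ≡ true → i ≡ c) →
    count p ≡ 1
  count-single p zero pc only =
    cong₂ _+_ (cong bit pc) (count-none (λ i → ¬-not (λ psi → contradiction (only (suc i) psi) λ ())))
  count-single p (suc c) pc only with p zero in p0
  ... | true = contradiction (only zero p0) λ ()
  ... | false = count-single (λ i → p (suc i)) c pc (λ i psi → suc-injective (only (suc i) psi))

  count-true : ∀ {n} → count {n} (λ _ → true) ≡ n
  count-true {zero} = refl
  count-true {suc n} = cong suc (count-true {n})

  count-complement : ∀ {n} (p : Fin n → Bool) → count p + count (λ i → not (p i)) ≡ n
  count-complement {n} p = begin
    count p + count (λ i → not (p i))  ≡⟨ count-∨ p _ (λ i → ∧-inverseʳ (p i)) ⟨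
    count (λ i → p i ∨ not (p i))      ≡⟨ count-cong (λ i → ∨-inverseʳ (p i)) ⟩
    count {n} (λ _ → true)             ≡⟨ count-true ⟩
    n                                  ∎
    where open ≡-Reasoning

  count-≤ : ∀ {n} (p : Fin n → Bool) → count p ≤ n
  count-≤ p = subst (count p ≤_) (count-complement p) (m≤m+n _ _)

  count-∧-lower : ∀ {n} (p r : Fin n → Bool) → count p + count r ≤ count (λ i → p i ∧ r i) + n
  count-∧-lower {n} p r = begin
    count p + count r                       ≡⟨ cong (_+ count r) (count-split p r) ⟩
    (both + count (λ i → p i ∧ not (r i))) + count r
                                            ≡⟨ +-assoc both _ _ ⟩
    both + (count (λ i → p i ∧ not (r i)) + count r)
                                            ≡⟨ cong (both +_) (count-∨ _ r disjoint) ⟨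
    both + count (λ i → (p i ∧ not (r i)) ∨ r i)
                                            ≤⟨ +-monoʳ-≤ both (count-≤ _) ⟩
    both + n                                ∎
    where
    open ≤-Reasoning
    both : ℕ
    both = count (λ i → p i ∧ r i)
    disjoint : ∀ i → (p i ∧ not (r i)) ∧ r i ≡ false
    disjoint i with p i | r i
    ... | true | true = refl
    ... | true | false = refl
    ... | false | _ = refl

  count-permute : ∀ {n} (π : Permutation′ n) (p : Fin n → Bool) →
    count (λ i → p (π ⟨$⟩ʳ i)) ≡ count p
  count-permute π p = sym (∑-permute (λ i → bit (p i)) π)

  count-↑ˡ : ∀ {m} n (p : Fin (m + n) → Bool) → count (λ i → p (i ↑ˡ n)) ≤ count p
  count-↑ˡ {zero} n p = z≤n
  count-↑ˡ {suc m} n p = +-monoʳ-≤ (bit (p zero)) (count-↑ˡ n (λ i → p (suc i)))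

  count-fibres : ∀ {n k} (f : Fin n → Fin k) (p : Fin n → Bool) →
    count p ≡ ∑[ y < k ] count (λ x → p x ∧ does (f x ≟ y))
  count-fibres {n} {k} f p = sym (begin
    ∑[ y < k ] ∑[ x < n ] bit (p x ∧ does (f x ≟ y))
      ≡⟨ ∑-comm (λ y x → bit (p x ∧ does (f x ≟ y))) ⟩
    ∑[ x < n ] ∑[ y < k ] bit (p x ∧ does (f x ≟ y))
      ≡⟨ sum-cong-≗ (λ x → fibre (p x) (f x)) ⟩
    count p ∎)
    where
    open ≡-Reasoning
    fibre : ∀ b (c : Fin k) → count (λ y → b ∧ does (c ≟ y)) ≡ bit b
    fibre true c = count-single _ c (dec-true (c ≟ c) refl) (λ y c≟y → sym (dec-witness (c ≟ y) c≟y))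
    fibre false c = count-false {k}

  -- Points moved by σ come in pairs {i , σ i}, each counted once by the member with i < σ i.
  count-involution : ∀ {n} (σ : Fin n → Fin n) → (∀ i → σ (σ i) ≡ i) →
    (p : Fin n → Bool) → (∀ i → p (σ i) ≡ p i) →
    ∃ λ k → count p ≡ count (λ i → p i ∧ does (σ i ≟ i)) + 2 * k
  count-involution σ σσ p pσ = count ascending , (begin
    count p                                                          ≡⟨ count-split p fixed ⟩
    count (λ i → p i ∧ fixed i) + count (λ i → p i ∧ not (fixed i))  ≡⟨ cong (count (λ i → p i ∧ fixed i) +_) moved ⟩
    count (λ i → p i ∧ fixed i) + 2 * count ascending                ∎)
    where
    open ≡-Reasoning
    fixed ascending descending : _ → Bool
    fixed i = does (σ i ≟ i)
    ascending i = p i ∧ does (i <? σ i)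
    descending i = p i ∧ does (σ i <? i)
    trichotomy : ∀ x y → bit (not (does (y ≟ x))) ≡ bit (does (x <? y)) + bit (does (y <? x))
    trichotomy x y with <-cmp x y
    ... | tri< x<y x≢y y≮x rewrite dec-false (y ≟ x) (λ e → x≢y (sym e)) | dec-true (x <? y) x<y
                                 | dec-false (y <? x) y≮x = refl
    ... | tri≈ x≮y x≡y y≮x rewrite dec-true (y ≟ x) (sym x≡y) | dec-false (x <? y) x≮y
                                 | dec-false (y <? x) y≮x = refl
    ... | tri> x≮y x≢y y<x rewrite dec-false (y ≟ x) (λ e → x≢y (sym e)) | dec-false (x <? y) x≮y
                                 | dec-true (y <? x) y<x = refl
    restrict : ∀ b e l g → bit (not e) ≡ bit l + bit g → bit (b ∧ not e) ≡ bit (b ∧ l) + bit (b ∧ g)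
    restrict true e l g h = h
    restrict false e l g h = refl
    swapped : count ascending ≡ count descending
    swapped = trans (count-cong (λ i → sym (cong₂ (λ a j → a ∧ does (j <? σ i)) (pσ i) (σσ i))))
                    (count-permute (permutation σ σ σσ σσ) descending)
    moved : count (λ i → p i ∧ not (fixed i)) ≡ 2 * count ascending
    moved = trans (count-pointwise _ ascending descending (λ i → restrict (p i) _ _ _ (trichotomy i (σ i))))
                  (cong (count ascending +_) (trans (sym swapped) (sym (+-identityʳ _))))

  ∧-cong-if : ∀ {a a′} b → (b ≡ true → a ≡ a′) → a ∧ b ≡ a′ ∧ b
  ∧-cong-if {a} {a′} true a≡a′ = trans (∧-identityʳ a) (trans (a≡a′ refl) (sym (∧-identityʳ a′)))
  ∧-cong-if {a} {a′} false _ = trans (∧-zeroʳ a) (sym (∧-zeroʳ a′))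

  ∧-true-split : ∀ {a b} → a ∧ b ≡ true → a ≡ true × b ≡ true
  ∧-true-split {true} {true} _ = refl , refl

  count-∧-witness : ∀ {n} (p r : Fin n → Bool) → n < count p + count r →
    ∃ λ i → p i ≡ true × r i ≡ true
  count-∧-witness {n} p r large = map₂ ∧-true-split (count-witness (λ i → p i ∧ r i) meets)
    where
    meets : 0 < count (λ i → p i ∧ r i)
    meets = +-cancelʳ-< n 0 (count (λ i → p i ∧ r i)) (<-≤-trans large (count-∧-lower p r))

  count≡0⇒false : ∀ {n} (p : Fin n → Bool) → count p ≡ 0 → ∀ i → p i ≡ false
  count≡0⇒false p p≡0 zero with p zero
  ... | false = refl
  count≡0⇒false p p≡0 (suc i) = count≡0⇒false (λ j → p (suc j)) (m+n≡0⇒n≡0 (bit (p zero)) p≡0) i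

module IdentifyingCodes where

  open import Defs
  open Counting
  open import Data.Bool using (Bool; true; false; _∨_; _xor_)
  open import Data.Bool.Properties using (⇔→≡; xor-same; ∨-zeroʳ)
  open import Data.Nat using (ℕ; suc; _+_; _≤_; _<_)
  open import Data.Nat.Properties using (<-≤-trans; +-monoʳ-≤)
  open import Data.Fin using (Fin)
  open import Data.Fin.Properties using (_≟_)
  open import Data.Sum using (inj₁; inj₂)
  open import Relation.Nullary.Decidable using (dec-true)
  open import Data.Fin.Subset using (Subset; _∈_; ∣_∣)
  open import Data.Vec using ([]; _∷_; lookup)
  open import Data.Vec.Properties using (lookup⇒[]=)
  open import Data.Product using (∃; _×_; _,_; proj₂)
  open import Relation.Nullary using (¬_; does)
  open import Function.Bundles using (_⇔_; mk⇔; Equivalence)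
  import Function.Properties.Equivalence as ⇔
  open import Function.Base using (_∘_)
  open import Relation.Binary.PropositionalEquality

  ∣∣≡count : ∀ {n} (C : Subset n) → ∣ C ∣ ≡ count (lookup C)
  ∣∣≡count [] = refl
  ∣∣≡count (true ∷ C) = cong suc (∣∣≡count C)
  ∣∣≡count (false ∷ C) = ∣∣≡count C

  closed : ∀ {n} → (Fin n → Fin n → Bool) → Fin n → Fin n → Bool
  closed adj x z = does (z ≟ x) ∨ adj x z

  closed-reflects : ∀ {n} (A : Fin n → Fin n → Set) (adj : Fin n → Fin n → Bool) →
    (∀ x y → adj x y ≡ true ⇔ A x y) → ∀ x z → closed adj x z ≡ true ⇔ z ∈N[ x ] A
  closed-reflects A adj adj⇔A x z = mk⇔ to-N from-N
    where
    to-N : closed adj x z ≡ true → z ∈N[ x ] A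
    to-N h with does (z ≟ x) in z≟x
    ... | true = inj₁ (dec-witness (z ≟ x) z≟x)
    ... | false = inj₂ (Equivalence.to (adj⇔A x z) h)
    from-N : z ∈N[ x ] A → closed adj x z ≡ true
    from-N (inj₁ refl) = cong (_∨ adj x x) (dec-true (x ≟ x) refl)
    from-N (inj₂ Axz) = trans (cong (does (z ≟ x) ∨_) (Equivalence.from (adj⇔A x z) Axz)) (∨-zeroʳ _)

  large⇒identifying : ∀ {n} (A : Fin n → Fin n → Set) (adj : Fin n → Fin n → Bool) →
    (∀ x y → adj x y ≡ true ⇔ A x y) → (K : ℕ) →
    (∀ x → K ≤ count (closed adj x)) →
    (∀ x y → x ≢ y → K ≤ count (λ z → closed adj x z xor closed adj y z)) →
    (C : Subset n) → n < ∣ C ∣ + K → Identifying A C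
  large⇒identifying {n} A adj adj⇔A K dominating separating C large = dominated , separated
    where
    N : Fin n → Fin n → Bool
    N = closed adj
    N⇔ : ∀ x z → N x z ≡ true ⇔ z ∈N[ x ] A
    N⇔ = closed-reflects A adj adj⇔A
    meets : (p : Fin n → Bool) → K ≤ count p → ∃ λ z → lookup C z ≡ true × p z ≡ true
    meets p K≤p = count-∧-witness (lookup C) p
      (<-≤-trans (subst (λ s → n < s + K) (∣∣≡count C) large) (+-monoʳ-≤ (count (lookup C)) K≤p))
    dominated : ∀ x → ∃ λ z → z ∈ C × z ∈N[ x ] A
    dominated x with meets (N x) (dominating x)
    ... | z , z∈C , Nxz = z , lookup⇒[]= z C z∈C , Equivalence.to (N⇔ x z) Nxz
    separated : ∀ x y → x ≢ y → ¬ (∀ z → (z ∈ C × z ∈N[ x ] A) ⇔ (z ∈ C × z ∈N[ y ] A))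
    separated x y x≢y same with meets (λ z → N x z xor N y z) (separating x y x≢y)
    ... | z , z∈C , Δxyz = true≢false (begin
      true               ≡⟨ Δxyz ⟨
      N x z xor N y z    ≡⟨ cong (N x z xor_) (⇔→≡ (mk⇔ (transfer same) (transfer (⇔.sym ∘ same)))) ⟨
      N x z xor N x z    ≡⟨ xor-same (N x z) ⟩
      false              ∎)
      where
      open ≡-Reasoning
      true≢false : true ≢ false
      true≢false ()
      transfer : ∀ {u v} → (∀ w → (w ∈ C × w ∈N[ u ] A) ⇔ (w ∈ C × w ∈N[ v ] A)) →
                 N u z ≡ true → N v z ≡ true
      transfer {u} {v} u⇔v Nuz = Equivalence.from (N⇔ v z)
        (proj₂ (Equivalence.to (u⇔v z) (lookup⇒[]= z C z∈C , Equivalence.to (N⇔ u z) Nuz)))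

module FiniteFieldFacts {q : ℕ} (F : FiniteField q) where

  open Counting
  open import Level using (0ℓ)
  open import Algebra.Bundles using (CommutativeRing)
  open import Data.Bool using (Bool; true; false; _∧_; _∨_; not)
  open import Data.Bool.Properties using (∧-identityʳ; ∧-zeroʳ)
  open import Data.Fin using (Fin)
  import Data.Fin.Properties as Fin
  open import Data.Fin.Permutation using (permutation)
  open import Data.Nat using (_+_; _*_)
  open import Data.Product using (∃; _,_; proj₁; proj₂)
  open import Data.Sum using (_⊎_; inj₁; inj₂)
  open import Function.Bundles using (Inverse)
  open import Relation.Binary.Definitions using (DecidableEquality)
  open import Relation.Binary.PropositionalEquality
  open import Relation.Nullary using (Dec; does; yes; no; map′; contradiction)
  import Data.Nat.Properties as ℕ
  open import Algebra.Properties.CommutativeMonoid.Sum ℕ.+-0-commutativeMonoid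
    using (sum-syntax; sum-cong-≗; ∑-distrib-+)
  import Algebra.Solver.CommutativeMonoid

  open FiniteField F public
  open Inverse enum using (from; strictlyInverseˡ; strictlyInverseʳ)
  open Inverse enum public using (to)

  ring : CommutativeRing 0ℓ 0ℓ
  ring = record { isCommutativeRing = isCommutativeRing }

  open CommutativeRing ring public
    using (+-assoc; +-comm; +-identityˡ; +-identityʳ; -‿inverseˡ; -‿inverseʳ;
           *-assoc; *-comm; *-identityˡ; *-identityʳ; zeroˡ; zeroʳ; distribˡ; distribʳ)
  open import Algebra.Properties.Ring (CommutativeRing.ring ring) public
    using (-‿involutive; -‿distribˡ-*; -‿distribʳ-*; -0#≈0#; -1*x≈-x; -‿+-comm; ⁻¹-anti-homo‿-;
           x∙y⁻¹≈ε⇒x≈y; +-inverseˡ-unique)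
  open Algebra.Solver.CommutativeMonoid (CommutativeRing.*-commutativeMonoid ring) public
    using (_⊕_; _⊜_) renaming (solve to *-solve)

  from-injective : ∀ {x y} → from x ≡ from y → x ≡ y
  from-injective {x} {y} e = trans (sym (strictlyInverseˡ x)) (trans (cong to e) (strictlyInverseˡ y))

  to-injective : ∀ {i j} → to i ≡ to j → i ≡ j
  to-injective {i} {j} e = trans (sym (strictlyInverseʳ i)) (trans (cong from e) (strictlyInverseʳ j))

  infix 4 _≟_
  _≟_ : DecidableEquality Carrier
  x ≟ y = map′ from-injective (cong from) (from x Fin.≟ from y)

  Count : (Carrier → Bool) → ℕ
  Count P = count (λ i → P (to i))

  Count-cong : ∀ {P Q : Carrier → Bool} → (∀ x → P x ≡ Q x) → Count P ≡ Count Q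
  Count-cong e = count-cong (λ i → e (to i))

  Count-none : ∀ {P : Carrier → Bool} → (∀ x → P x ≡ false) → Count P ≡ 0
  Count-none e = count-none (λ i → e (to i))

  Count-single : ∀ (P : Carrier → Bool) c → P c ≡ true → (∀ x → P x ≡ true → x ≡ c) →
    Count P ≡ 1
  Count-single P c Pc only =
    count-single (λ i → P (to i)) (from c) (subst (λ x → P x ≡ true) (sym (strictlyInverseˡ c)) Pc)
    (λ i Pi → trans (sym (strictlyInverseʳ i)) (cong from (only (to i) Pi)))

  Count-pointwise : ∀ (P Q R : Carrier → Bool) → (∀ x → bit (P x) ≡ bit (Q x) + bit (R x)) →
    Count P ≡ Count Q + Count R
  Count-pointwise P Q R e = count-pointwise _ _ _ (λ i → e (to i))

  Count≡0⇒false : ∀ (P : Carrier → Bool) → Count P ≡ 0 → ∀ x → P x ≡ false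
  Count≡0⇒false P P≡0 x =
    subst (λ y → P y ≡ false) (strictlyInverseˡ x) (count≡0⇒false (λ i → P (to i)) P≡0 (from x))

  Count-∧-const : ∀ (P : Carrier → Bool) b → Count (λ x → P x ∧ b) ≡ bit b * Count P
  Count-∧-const P true = trans (Count-cong (λ x → ∧-identityʳ (P x))) (sym (ℕ.+-identityʳ (Count P)))
  Count-∧-const P false = Count-none (λ x → ∧-zeroʳ (P x))

  Count-split : ∀ (P Q : Carrier → Bool) →
    Count P ≡ Count (λ x → P x ∧ Q x) + Count (λ x → P x ∧ not (Q x))
  Count-split P Q = count-split (λ i → P (to i)) (λ i → Q (to i))

  Count-∨ : ∀ (P Q : Carrier → Bool) → (∀ x → P x ∧ Q x ≡ false) →
    Count (λ x → P x ∨ Q x) ≡ Count P + Count Q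
  Count-∨ P Q disjoint = count-∨ (λ i → P (to i)) (λ i → Q (to i)) (λ i → disjoint (to i))

  Count-complement : ∀ (P : Carrier → Bool) → Count P + Count (λ x → not (P x)) ≡ q
  Count-complement P = count-complement (λ i → P (to i))

  Count-all : Count (λ _ → true) ≡ q
  Count-all = count-true

  onFin : (Carrier → Carrier) → Fin q → Fin q
  onFin f i = from (f (to i))

  onFin-inverse : ∀ {f g : Carrier → Carrier} → (∀ x → f (g x) ≡ x) → ∀ i → onFin f (onFin g i) ≡ i
  onFin-inverse {f} {g} fg i = trans (cong (λ x → from (f x)) (strictlyInverseˡ (g (to i))))
                                     (trans (cong from (fg (to i))) (strictlyInverseʳ i))

  does-≟-to : ∀ x i → does (x ≟ to i) ≡ does (from x Fin.≟ i)
  does-≟-to x i = cong (λ j → does (from x Fin.≟ j)) (strictlyInverseʳ i)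

  Count-bijection : (σ τ : Carrier → Carrier) → (∀ x → τ (σ x) ≡ x) → (∀ x → σ (τ x) ≡ x) →
    ∀ (P : Carrier → Bool) → Count (λ x → P (σ x)) ≡ Count P
  Count-bijection σ τ τσ στ P =
    trans (count-cong (λ i → cong P (sym (strictlyInverseˡ (σ (to i))))))
          (count-permute (permutation (onFin σ) (onFin τ) (onFin-inverse {σ} {τ} στ) (onFin-inverse {τ} {σ} τσ))
                         (λ i → P (to i)))

  Count-involution : (σ : Carrier → Carrier) → (∀ x → σ (σ x) ≡ x) →
    ∀ (P : Carrier → Bool) → (∀ x → P (σ x) ≡ P x) →
    ∃ λ k → Count P ≡ Count (λ x → P x ∧ does (σ x ≟ x)) + 2 * k
  Count-involution σ σσ P Pσ with count-involution (onFin σ) (onFin-inverse {σ} {σ} σσ) (λ i → P (to i)) Pπ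
    where
    Pπ : ∀ i → P (to (onFin σ i)) ≡ P (to i)
    Pπ i = trans (cong P (strictlyInverseˡ (σ (to i)))) (Pσ (to i))
  ... | k , split = k , trans split
    (cong (_+ 2 * k) (count-cong (λ i → cong (P (to i) ∧_) (sym (does-≟-to (σ (to i)) i)))))

  Sum : (Carrier → ℕ) → ℕ
  Sum f = ∑[ i < q ] f (to i)

  Sum-cong : ∀ {f g : Carrier → ℕ} → (∀ x → f x ≡ g x) → Sum f ≡ Sum g
  Sum-cong e = sum-cong-≗ (λ i → e (to i))

  Sum-+ : ∀ (f g : Carrier → ℕ) → Sum (λ x → f x + g x) ≡ Sum f + Sum g
  Sum-+ f g = ∑-distrib-+ (λ i → f (to i)) (λ i → g (to i))

  Count-fibres : (f : Carrier → Carrier) → ∀ (P : Carrier → Bool) →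
    Count P ≡ Sum (λ y → Count (λ x → P x ∧ does (f x ≟ y)))
  Count-fibres f P = trans (count-fibres (onFin f) (λ i → P (to i)))
    (sum-cong-≗ (λ y → count-cong (λ i → cong (P (to i) ∧_) (sym (does-≟-to (f (to i)) y)))))

  1≢0 : 1F ≢ 0F
  1≢0 e = 0≢1 (sym e)

  x-y≡0⇒x≡y : ∀ x y → x -F y ≡ 0F → x ≡ y
  x-y≡0⇒x≡y = x∙y⁻¹≈ε⇒x≈y

  x-x≡0 : ∀ x → x -F x ≡ 0F
  x-x≡0 = -‿inverseʳ

  -[x-y]≡y-x : ∀ x y → -F (x -F y) ≡ y -F x
  -[x-y]≡y-x = ⁻¹-anti-homo‿-

  x-[y+z]≡x-y-z : ∀ x y z → x -F (y +F z) ≡ (x -F y) -F z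
  x-[y+z]≡x-y-z x y z = begin
    x +F (-F (y +F z))          ≡⟨ cong (x +F_) (-‿+-comm y z) ⟨
    x +F ((-F y) +F (-F z))     ≡⟨ +-assoc x (-F y) (-F z) ⟨
    (x -F y) -F z               ∎
    where open ≡-Reasoning

  x+[y-x]≡y : ∀ x y → x +F (y -F x) ≡ y
  x+[y-x]≡y x y = begin
    x +F (y +F (-F x))     ≡⟨ +-comm x (y -F x) ⟩
    (y +F (-F x)) +F x     ≡⟨ +-assoc y (-F x) x ⟩
    y +F ((-F x) +F x)     ≡⟨ cong (y +F_) (-‿inverseˡ x) ⟩
    y +F 0F                ≡⟨ +-identityʳ y ⟩
    y                      ∎
    where open ≡-Reasoning

  [x+y]-x≡y : ∀ x y → (x +F y) -F x ≡ y
  [x+y]-x≡y x y =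
    trans (cong (_-F x) (+-comm x y)) (trans (+-assoc y x (-F x)) (trans (cong (y +F_) (x-x≡0 x)) (+-identityʳ y)))

  [x-y]-x≡-y : ∀ x y → (x -F y) -F x ≡ -F y
  [x-y]-x≡-y x y = trans (cong (_-F x) (+-comm x (-F y)))
    (trans (+-assoc (-F y) x (-F x)) (trans (cong ((-F y) +F_) (x-x≡0 x)) (+-identityʳ (-F y))))

  x-[x+y]≡-y : ∀ x y → x -F (x +F y) ≡ -F y
  x-[x+y]≡-y x y = trans (x-[y+z]≡x-y-z x x y) (trans (cong (_-F y) (x-x≡0 x)) (+-identityˡ (-F y)))

  x*-[y-1]≡x-xy : ∀ x y → x *F (-F (y -F 1F)) ≡ x -F (x *F y)
  x*-[y-1]≡x-xy x y = begin
    x *F (-F (y -F 1F))           ≡⟨ cong (x *F_) (-[x-y]≡y-x y 1F) ⟩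
    x *F (1F +F (-F y))           ≡⟨ distribˡ x 1F (-F y) ⟩
    (x *F 1F) +F (x *F (-F y))    ≡⟨ cong₂ _+F_ (*-identityʳ x) (sym (-‿distribʳ-* x y)) ⟩
    x -F (x *F y)                 ∎
    where open ≡-Reasoning

  noZeroDivisors : ∀ a b → a *F b ≡ 0F → a ≡ 0F ⊎ b ≡ 0F
  noZeroDivisors a b ab≡0 with a ≟ 0F
  ... | yes a≡0 = inj₁ a≡0
  ... | no a≢0 with inverse a a≢0
  ... | c , ac≡1 = inj₂ (begin
    b                ≡⟨ *-identityˡ b ⟨
    1F *F b          ≡⟨ cong (_*F b) ac≡1 ⟨
    (a *F c) *F b    ≡⟨ *-solve 3 (λ a b c → (a ⊕ c) ⊕ b ⊜ c ⊕ (a ⊕ b)) refl a b c ⟩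
    c *F (a *F b)    ≡⟨ cong (c *F_) ab≡0 ⟩
    c *F 0F          ≡⟨ zeroʳ c ⟩
    0F               ∎)
    where open ≡-Reasoning

  *-nonzero : ∀ {a b} → a ≢ 0F → b ≢ 0F → a *F b ≢ 0F
  *-nonzero {a} {b} a≢0 b≢0 ab≡0 with noZeroDivisors a b ab≡0
  ... | inj₁ a≡0 = a≢0 a≡0
  ... | inj₂ b≡0 = b≢0 b≡0

  x*x≡y*y⇒x≡±y : ∀ x y → x *F x ≡ y *F y → x ≡ y ⊎ x ≡ -F y
  x*x≡y*y⇒x≡±y x y xx≡yy with noZeroDivisors (x -F y) (x +F y) product≡0
    where
    product≡0 : (x -F y) *F (x +F y) ≡ 0F
    product≡0 = begin
      (x -F y) *F (x +F y)                   ≡⟨ distribʳ (x +F y) x (-F y) ⟩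
      (x *F (x +F y)) +F ((-F y) *F (x +F y)) ≡⟨ cong ((x *F (x +F y)) +F_) (-‿distribˡ-* y (x +F y)) ⟨
      (x *F (x +F y)) -F (y *F (x +F y))     ≡⟨ cong (λ z → (x *F (x +F y)) -F z) y[x+y]≡x[x+y] ⟩
      (x *F (x +F y)) -F (x *F (x +F y))     ≡⟨ x-x≡0 (x *F (x +F y)) ⟩
      0F                                     ∎
      where
      open ≡-Reasoning
      y[x+y]≡x[x+y] : y *F (x +F y) ≡ x *F (x +F y)
      y[x+y]≡x[x+y] = begin
        y *F (x +F y)          ≡⟨ distribˡ y x y ⟩
        (y *F x) +F (y *F y)   ≡⟨ cong₂ _+F_ (*-comm y x) (sym xx≡yy) ⟩
        (x *F y) +F (x *F x)   ≡⟨ +-comm (x *F y) (x *F x) ⟩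
        (x *F x) +F (x *F y)   ≡⟨ distribˡ x x y ⟨
        x *F (x +F y)          ∎
  ... | inj₁ x-y≡0 = inj₁ (x-y≡0⇒x≡y x y x-y≡0)
  ... | inj₂ x+y≡0 = inj₂ (+-inverseˡ-unique x y x+y≡0)

  -- A total inverse, with the junk value 0⁻¹ = 0.
  infix 30 _⁻¹

  _⁻¹ : Carrier → Carrier
  x ⁻¹ with x ≟ 0F
  ... | yes _ = 0F
  ... | no x≢0 = proj₁ (inverse x x≢0)

  ⁻¹-inverseʳ : ∀ {x} → x ≢ 0F → x *F x ⁻¹ ≡ 1F
  ⁻¹-inverseʳ {x} x≢0 with x ≟ 0F
  ... | yes x≡0 = contradiction x≡0 x≢0
  ... | no x≢0′ = proj₂ (inverse x x≢0′)

  ⁻¹-inverseˡ : ∀ {x} → x ≢ 0F → x ⁻¹ *F x ≡ 1F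
  ⁻¹-inverseˡ {x} x≢0 = trans (*-comm (x ⁻¹) x) (⁻¹-inverseʳ x≢0)

  0⁻¹≡0 : 0F ⁻¹ ≡ 0F
  0⁻¹≡0 with 0F ≟ 0F
  ... | yes _ = refl
  ... | no 0≢0 = contradiction refl 0≢0

  ⁻¹-nonzero : ∀ {x} → x ≢ 0F → x ⁻¹ ≢ 0F
  ⁻¹-nonzero {x} x≢0 x⁻¹≡0 = 1≢0 (begin
    1F             ≡⟨ ⁻¹-inverseʳ x≢0 ⟨
    x *F x ⁻¹      ≡⟨ cong (x *F_) x⁻¹≡0 ⟩
    x *F 0F        ≡⟨ zeroʳ x ⟩
    0F             ∎)
    where open ≡-Reasoning

  ⁻¹-unique : ∀ x y → x *F y ≡ 1F → y ≡ x ⁻¹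
  ⁻¹-unique x y xy≡1 = begin
    y                    ≡⟨ *-identityʳ y ⟨
    y *F 1F              ≡⟨ cong (y *F_) (⁻¹-inverseʳ x≢0) ⟨
    y *F (x *F x ⁻¹)     ≡⟨ *-solve 3 (λ x y z → y ⊕ (x ⊕ z) ⊜ (x ⊕ y) ⊕ z) refl x y (x ⁻¹) ⟩
    (x *F y) *F x ⁻¹     ≡⟨ cong (_*F x ⁻¹) xy≡1 ⟩
    1F *F x ⁻¹           ≡⟨ *-identityˡ (x ⁻¹) ⟩
    x ⁻¹                 ∎
    where
    open ≡-Reasoning
    x≢0 : x ≢ 0F
    x≢0 x≡0 = 1≢0 (trans (sym xy≡1) (trans (cong (_*F y) x≡0) (zeroˡ y)))

  ⁻¹-involutive : ∀ x → x ⁻¹ ⁻¹ ≡ x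
  ⁻¹-involutive x = by-cases (x ≟ 0F)
    where
    by-cases : Dec (x ≡ 0F) → x ⁻¹ ⁻¹ ≡ x
    by-cases (yes x≡0) =
      trans (cong (λ y → y ⁻¹ ⁻¹) x≡0) (trans (cong _⁻¹ 0⁻¹≡0) (trans 0⁻¹≡0 (sym x≡0)))
    by-cases (no x≢0) = sym (⁻¹-unique (x ⁻¹) x (⁻¹-inverseˡ x≢0))

  1⁻¹≡1 : 1F ⁻¹ ≡ 1F
  1⁻¹≡1 = sym (⁻¹-unique 1F 1F (*-identityˡ 1F))

  ⁻¹-cancelˡ : ∀ {t} → t ≢ 0F → ∀ x → t ⁻¹ *F (t *F x) ≡ x
  ⁻¹-cancelˡ {t} t≢0 x =
    trans (sym (*-assoc (t ⁻¹) t x)) (trans (cong (_*F x) (⁻¹-inverseˡ t≢0)) (*-identityˡ x))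

  ⁻¹-cancelʳ : ∀ {t} → t ≢ 0F → ∀ x → t *F (t ⁻¹ *F x) ≡ x
  ⁻¹-cancelʳ {t} t≢0 x =
    trans (sym (*-assoc t (t ⁻¹) x)) (trans (cong (_*F x) (⁻¹-inverseʳ t≢0)) (*-identityˡ x))

  square? : ∀ d → Dec (∃ λ a → a *F a ≡ d)
  square? d =
    map′ (λ (i , e) → to i , e) (λ (a , e) → from a , trans (cong (λ x → x *F x) (strictlyInverseˡ a)) e)
    (Fin.any? (λ i → (to i *F to i) ≟ d))

module QuadraticCharacter {q : ℕ} (F : FiniteField q) where

  open Counting
  open FiniteFieldFacts F
  open import Data.Bool using (Bool; true; false; _∧_; _∨_; not)
  open import Data.Bool.Properties using (∧-zeroʳ; ∧-identityʳ)
  open import Data.Nat using (suc; _+_; _*_)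
  import Data.Nat.Properties as ℕ
  open import Data.Product using (_,_)
  open import Data.Sum using (_⊎_; inj₁; inj₂; [_,_]′; reduce)
  open import Function.Bundles using (_⇔_; mk⇔)
  open import Relation.Binary.PropositionalEquality
  open import Relation.Nullary using (Dec; does; yes; no; contradiction)
  open import Relation.Nullary.Decidable using (dec-true; dec-false; does-⇔; _⊎-dec_)

  -- The values 0, 1, -1 of the quadratic character χ, with their multiplication _·_.
  data Class : Set where
    null square nonsquare : Class

  infixl 7 _·_
  _·_ : Class → Class → Class
  null · _ = null
  square · c = c
  nonsquare · null = null
  nonsquare · square = nonsquare
  nonsquare · nonsquare = square

  infix 4 _==_
  _==_ : Class → Class → Bool
  null == null = true
  square == square = true
  nonsquare == nonsquare = true
  _ == _ = false

  ==-sound : ∀ {c c′} → (c == c′) ≡ true → c ≡ c′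
  ==-sound {null} {null} _ = refl
  ==-sound {square} {square} _ = refl
  ==-sound {nonsquare} {nonsquare} _ = refl

  χ : Carrier → Class
  χ d with d ≟ 0F | square? d
  ... | yes _ | _ = null
  ... | no _ | yes _ = square
  ... | no _ | no _ = nonsquare

  data View (d : Carrier) : Class → Set where
    null : d ≡ 0F → View d null
    square : d ≢ 0F → ∀ a → a *F a ≡ d → View d square
    nonsquare : d ≢ 0F → (∀ a → a *F a ≢ d) → View d nonsquare

  view : ∀ d → View d (χ d)
  view d with d ≟ 0F | square? d
  ... | yes d≡0 | _ = null d≡0
  ... | no d≢0 | yes (a , aa≡d) = square d≢0 a aa≡d
  ... | no d≢0 | no none = nonsquare d≢0 (λ a aa≡d → none (a , aa≡d))

  χ-null : ∀ {d} → d ≡ 0F → χ d ≡ null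
  χ-null {d} d≡0 with χ d | view d
  ... | null | _ = refl
  ... | square | square d≢0 _ _ = contradiction d≡0 d≢0
  ... | nonsquare | nonsquare d≢0 _ = contradiction d≡0 d≢0

  χ≡null⇒ : ∀ {d} → χ d ≡ null → d ≡ 0F
  χ≡null⇒ {d} χd≡null with χ d | view d
  χ≡null⇒ {d} refl | null | null d≡0 = d≡0

  χ-nonzero : ∀ {d} → d ≢ 0F → χ d ≢ null
  χ-nonzero d≢0 χd≡null = d≢0 (χ≡null⇒ χd≡null)

  χ-square : ∀ {d} a → d ≢ 0F → a *F a ≡ d → χ d ≡ square
  χ-square {d} a d≢0 aa≡d with χ d | view d
  ... | null | null d≡0 = contradiction d≡0 d≢0
  ... | square | _ = refl
  ... | nonsquare | nonsquare _ none = contradiction aa≡d (none a)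

  χ-nonsquare : ∀ {d} → d ≢ 0F → (∀ a → a *F a ≢ d) → χ d ≡ nonsquare
  χ-nonsquare {d} d≢0 none with χ d | view d
  ... | null | null d≡0 = contradiction d≡0 d≢0
  ... | square | square _ a aa≡d = contradiction aa≡d (none a)
  ... | nonsquare | _ = refl

  χ≡square⇔IsNonzeroSquare : ∀ {d} → χ d ≡ square ⇔ IsNonzeroSquare d
  χ≡square⇔IsNonzeroSquare {d} = mk⇔ to-square (λ (d≢0 , a , aa≡d) → χ-square a d≢0 aa≡d)
    where
    to-square : χ d ≡ square → IsNonzeroSquare d
    to-square χd≡square with χ d | view d
    to-square refl | square | square d≢0 a aa≡d = d≢0 , a , aa≡d

  χ-1 : χ 1F ≡ square
  χ-1 = χ-square 1F 1≢0 (*-identityˡ 1F)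

  χ-square-* : ∀ {d} a → χ d ≡ square → χ (d *F a) ≡ χ a
  χ-square-* {d} a χd≡square with χ d | view d
  χ-square-* {d} a refl | square | square d≢0 c cc≡d with χ a | view a
  ... | null | null a≡0 = χ-null (trans (cong (d *F_) a≡0) (zeroʳ d))
  ... | square | square a≢0 b bb≡a = χ-square (c *F b) (*-nonzero d≢0 a≢0) (begin
    (c *F b) *F (c *F b)   ≡⟨ *-solve 2 (λ c b → (c ⊕ b) ⊕ (c ⊕ b) ⊜ (c ⊕ c) ⊕ (b ⊕ b)) refl c b ⟩
    (c *F c) *F (b *F b)   ≡⟨ cong₂ _*F_ cc≡d bb≡a ⟩
    d *F a                 ∎)
    where open ≡-Reasoning
  ... | nonsquare | nonsquare a≢0 none = χ-nonsquare (*-nonzero d≢0 a≢0) (λ e ee≡da → none (e *F c ⁻¹) (root e ee≡da))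
    where
    open ≡-Reasoning
    c≢0 : c ≢ 0F
    c≢0 c≡0 = d≢0 (trans (sym cc≡d) (trans (cong (_*F c) c≡0) (zeroˡ c)))
    root : ∀ e → e *F e ≡ d *F a → (e *F c ⁻¹) *F (e *F c ⁻¹) ≡ a
    root e ee≡da = begin
      (e *F c ⁻¹) *F (e *F c ⁻¹)
        ≡⟨ *-solve 2 (λ e c′ → (e ⊕ c′) ⊕ (e ⊕ c′) ⊜ (e ⊕ e) ⊕ (c′ ⊕ c′)) refl e (c ⁻¹) ⟩
      (e *F e) *F (c ⁻¹ *F c ⁻¹)
        ≡⟨ cong (_*F (c ⁻¹ *F c ⁻¹)) (trans ee≡da (cong (_*F a) (sym cc≡d))) ⟩
      ((c *F c) *F a) *F (c ⁻¹ *F c ⁻¹)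
        ≡⟨ *-solve 3 (λ c a c′ → ((c ⊕ c) ⊕ a) ⊕ (c′ ⊕ c′) ⊜ a ⊕ ((c ⊕ c′) ⊕ (c ⊕ c′))) refl c a (c ⁻¹) ⟩
      a *F ((c *F c ⁻¹) *F (c *F c ⁻¹))     ≡⟨ cong (λ u → a *F (u *F u)) (⁻¹-inverseʳ c≢0) ⟩
      a *F (1F *F 1F)                       ≡⟨ cong (a *F_) (*-identityˡ 1F) ⟩
      a *F 1F                               ≡⟨ *-identityʳ a ⟩
      a                                     ∎

  χ-⁻¹ : ∀ x → χ (x ⁻¹) ≡ χ x
  χ-⁻¹ x = by-cases (x ≟ 0F)
    where
    by-cases : Dec (x ≡ 0F) → χ (x ⁻¹) ≡ χ x
    by-cases (yes x≡0) = trans (χ-null (trans (cong _⁻¹ x≡0) 0⁻¹≡0)) (sym (χ-null x≡0))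
    by-cases (no x≢0) =
      trans (cong χ x⁻¹≡x⁻¹x⁻¹x) (χ-square-* x (χ-square (x ⁻¹) (*-nonzero x⁻¹≢0 x⁻¹≢0) refl))
      where
      x⁻¹≢0 : x ⁻¹ ≢ 0F
      x⁻¹≢0 = ⁻¹-nonzero x≢0
      x⁻¹≡x⁻¹x⁻¹x : x ⁻¹ ≡ (x ⁻¹ *F x ⁻¹) *F x
      x⁻¹≡x⁻¹x⁻¹x = begin
        x ⁻¹                       ≡⟨ *-identityʳ (x ⁻¹) ⟨
        x ⁻¹ *F 1F                 ≡⟨ cong (x ⁻¹ *F_) (⁻¹-inverseˡ x≢0) ⟨
        x ⁻¹ *F (x ⁻¹ *F x)        ≡⟨ *-assoc (x ⁻¹) (x ⁻¹) x ⟨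
        (x ⁻¹ *F x ⁻¹) *F x        ∎
        where open ≡-Reasoning

  Count-by-class : ∀ (P : Carrier → Bool) (g : Carrier → Class) →
    Count P ≡ Count (λ x → P x ∧ (g x == null))
            + (Count (λ x → P x ∧ (g x == square)) + Count (λ x → P x ∧ (g x == nonsquare)))
  Count-by-class P g =
    trans (Count-pointwise P _ (λ x → is square x ∨ is nonsquare x) (λ x → by-class (P x) (g x)))
          (cong (Count (is null) +_) (Count-∨ (is square) (is nonsquare) (λ x → disjoint (P x) (g x))))
    where
    is : Class → Carrier → Bool
    is c x = P x ∧ (g x == c)
    by-class : ∀ b c → bit b ≡ bit (b ∧ (c == null)) + bit ((b ∧ (c == square)) ∨ (b ∧ (c == nonsquare)))
    by-class false _ = refl
    by-class true null = refl
    by-class true square = refl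
    by-class true nonsquare = refl
    disjoint : ∀ b c → (b ∧ (c == square)) ∧ (b ∧ (c == nonsquare)) ≡ false
    disjoint false _ = refl
    disjoint true null = refl
    disjoint true square = refl
    disjoint true nonsquare = refl

  Count-through-class : ∀ (g : Carrier → Class) (f : Class → Bool) →
    Count (λ x → f (g x)) ≡ bit (f null) * Count (λ x → g x == null)
                          + (bit (f square) * Count (λ x → g x == square)
                          + bit (f nonsquare) * Count (λ x → g x == nonsquare))
  Count-through-class g f = trans (Count-by-class (λ x → f (g x)) g)
    (cong₂ _+_ (by null) (cong₂ _+_ (by square) (by nonsquare)))
    where
    restrict : ∀ c′ c → f c′ ∧ (c′ == c) ≡ (c′ == c) ∧ f c
    restrict c′ c with c′ == c in c′==c
    ... | true = trans (∧-identityʳ (f c′)) (cong f (==-sound c′==c))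
    ... | false = ∧-zeroʳ (f c′)
    by : ∀ c → Count (λ x → f (g x) ∧ (g x == c)) ≡ bit (f c) * Count (λ x → g x == c)
    by c = trans (Count-cong (λ x → restrict (g x) c)) (Count-∧-const (λ x → g x == c) (f c))

  module OddOrder (n : ℕ) (q≡1+2n : q ≡ suc (2 * n)) where

    -- Otherwise x ↦ x + 1 would be a fixed-point-free involution of a set of odd size.
    1+1≢0 : 1F +F 1F ≢ 0F
    1+1≢0 2≡0 with Count-involution (_+F 1F) +1+1 (λ _ → true) (λ _ → refl)
      where
      +1+1 : ∀ x → (x +F 1F) +F 1F ≡ x
      +1+1 x = trans (+-assoc x 1F 1F) (trans (cong (x +F_) 2≡0) (+-identityʳ x))
    ... | k , q≡fixed+2k = ℕ.even≢odd k n (begin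
      2 * k                                    ≡⟨ cong (_+ 2 * k) (Count-none (λ x → dec-false (x +F 1F ≟ x) (x+1≢x x))) ⟨
      Count (λ x → does (x +F 1F ≟ x)) + 2 * k ≡⟨ q≡fixed+2k ⟨
      Count (λ _ → true)                      ≡⟨ Count-all ⟩
      q                                       ≡⟨ q≡1+2n ⟩
      suc (2 * n)                             ∎)
      where
      open ≡-Reasoning
      x+1≢x : ∀ x → x +F 1F ≢ x
      x+1≢x x x+1≡x = 1≢0 (begin
        1F                       ≡⟨ +-identityˡ 1F ⟨
        0F +F 1F                 ≡⟨ cong (_+F 1F) (-‿inverseˡ x) ⟨
        ((-F x) +F x) +F 1F      ≡⟨ +-assoc (-F x) x 1F ⟩
        (-F x) +F (x +F 1F)      ≡⟨ cong ((-F x) +F_) x+1≡x ⟩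
        (-F x) +F x              ≡⟨ -‿inverseˡ x ⟩
        0F                       ∎)

    x≢-x : ∀ {a} → a ≢ 0F → a ≢ -F a
    x≢-x {a} a≢0 a≡-a with noZeroDivisors (1F +F 1F) a 2a≡0
      where
      2a≡0 : (1F +F 1F) *F a ≡ 0F
      2a≡0 = begin
        (1F +F 1F) *F a          ≡⟨ distribʳ a 1F 1F ⟩
        (1F *F a) +F (1F *F a)   ≡⟨ cong₂ _+F_ (*-identityˡ a) (*-identityˡ a) ⟩
        a +F a                   ≡⟨ cong (a +F_) a≡-a ⟩
        a -F a                   ≡⟨ x-x≡0 a ⟩
        0F                       ∎
        where open ≡-Reasoning
    ... | inj₁ 2≡0 = 1+1≢0 2≡0
    ... | inj₂ a≡0 = a≢0 a≡0

    roots : Class → ℕ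
    roots null = 1
    roots square = 2
    roots nonsquare = 0

    Count-roots : ∀ d → Count (λ x → does (x *F x ≟ d)) ≡ roots (χ d)
    Count-roots d with χ d | view d
    ... | null | null d≡0 = Count-single _ 0F (dec-true (0F *F 0F ≟ d) (trans (zeroˡ 0F) (sym d≡0)))
      (λ x xx≡d → reduce (noZeroDivisors x x (trans (dec-witness (x *F x ≟ d) xx≡d) d≡0)))
    ... | square | square d≢0 a aa≡d = begin
      Count (λ x → does (x *F x ≟ d))
        ≡⟨ Count-cong (λ x → does-⇔ (±root x) (x *F x ≟ d) (x ≟ a ⊎-dec x ≟ -F a)) ⟩
      Count (λ x → does (x ≟ a) ∨ does (x ≟ -F a))
        ≡⟨ Count-∨ (λ x → does (x ≟ a)) _ distinct ⟩
      Count (λ x → does (x ≟ a)) + Count (λ x → does (x ≟ -F a))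
        ≡⟨ cong₂ _+_ (Count-single _ a (dec-true (a ≟ a) refl) (λ x → dec-witness (x ≟ a)))
                     (Count-single _ (-F a) (dec-true (-F a ≟ -F a) refl) (λ x → dec-witness (x ≟ -F a))) ⟩
      2                                                     ∎
      where
      open ≡-Reasoning
      a≢0 : a ≢ 0F
      a≢0 a≡0 = d≢0 (trans (sym aa≡d) (trans (cong (_*F a) a≡0) (zeroˡ a)))
      -a*-a≡d : (-F a) *F (-F a) ≡ d
      -a*-a≡d = begin
        (-F a) *F (-F a)     ≡⟨ -‿distribˡ-* a (-F a) ⟨
        -F (a *F (-F a))     ≡⟨ cong -F_ (-‿distribʳ-* a a) ⟨
        -F (-F (a *F a))     ≡⟨ -‿involutive (a *F a) ⟩
        a *F a               ≡⟨ aa≡d ⟩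
        d                    ∎
      ±root : ∀ x → x *F x ≡ d ⇔ (x ≡ a ⊎ x ≡ -F a)
      ±root x = mk⇔ (λ xx≡d → x*x≡y*y⇒x≡±y x a (trans xx≡d (sym aa≡d)))
                    [ (λ { refl → aa≡d }) , (λ { refl → -a*-a≡d }) ]′
      distinct : ∀ x → does (x ≟ a) ∧ does (x ≟ -F a) ≡ false
      distinct x with does (x ≟ a) in x≟a
      ... | false = refl
      ... | true = dec-false (x ≟ -F a) (λ x≡-a → x≢-x a≢0 (trans (sym (dec-witness (x ≟ a) x≟a)) x≡-a))
    ... | nonsquare | nonsquare _ none = Count-none (λ x → dec-false (x *F x ≟ d) (none x))

    #null : Count (λ x → χ x == null) ≡ 1
    #null = Count-single _ 0F (cong (_== null) (χ-null refl)) (λ x χx==null → χ≡null⇒ (==-sound χx==null))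

    #squares : Count (λ x → χ x == square) ≡ n
    #squares = ℕ.*-cancelˡ-≡ _ _ 2 (ℕ.suc-injective (begin
      suc (2 * S)                           ≡⟨ cong (λ k → suc (S + k)) (ℕ.+-identityʳ S) ⟩
      suc (S + S)                           ≡⟨ cong (_+ (S + S)) #null ⟨
      Count (λ x → χ x == null) + (S + S)   ≡⟨ cong (Count (λ x → χ x == null) +_) (Sum-+ is-square is-square) ⟨
      Count (λ x → χ x == null) + Sum (λ y → is-square y + is-square y)
                                            ≡⟨ Sum-+ (λ y → bit (χ y == null)) (λ y → is-square y + is-square y) ⟨
      Sum (λ y → roots′ (χ y))              ≡⟨ Sum-cong (λ y → trans (roots′≡roots (χ y)) (sym (Count-roots y))) ⟩
      Sum (λ y → Count (λ x → does (x *F x ≟ y))) ≡⟨ Count-fibres (λ x → x *F x) (λ _ → true) ⟨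
      Count (λ _ → true)                    ≡⟨ Count-all ⟩
      q                                     ≡⟨ q≡1+2n ⟩
      suc (2 * n)                           ∎))
      where
      open ≡-Reasoning
      S : ℕ
      S = Count (λ x → χ x == square)
      is-square : Carrier → ℕ
      is-square y = bit (χ y == square)
      roots′ : Class → ℕ
      roots′ c = bit (c == null) + (bit (c == square) + bit (c == square))
      roots′≡roots : ∀ c → roots′ c ≡ roots c
      roots′≡roots null = refl
      roots′≡roots square = refl
      roots′≡roots nonsquare = refl

    #nonsquares : Count (λ x → χ x == nonsquare) ≡ n
    #nonsquares = ℕ.+-cancelˡ-≡ (suc n) _ _ (begin
      suc n + Count (λ x → χ x == nonsquare)
        ≡⟨ cong₂ (λ a b → a + (b + Count (λ x → χ x == nonsquare))) #null #squares ⟨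
      Count (λ x → χ x == null) + (Count (λ x → χ x == square) + Count (λ x → χ x == nonsquare))
                                                 ≡⟨ Count-by-class (λ _ → true) χ ⟨
      Count (λ _ → true)                         ≡⟨ trans Count-all q≡1+2n ⟩
      suc (2 * n)                                ≡⟨ cong (λ k → suc (n + k)) (ℕ.+-identityʳ n) ⟩
      suc n + n                                  ∎)
      where open ≡-Reasoning

    -- Multiplication by t maps the n squares into the n elements x with χ (t x) nonsquare,
    -- so it maps no nonsquare there.
    χ-nonsquare-* : ∀ {t a} → χ t ≡ nonsquare → χ a ≡ nonsquare → χ (t *F a) ≡ square
    χ-nonsquare-* {t} {a} χt≡nonsquare χa≡nonsquare with χ (t *F a) in χta
    ... | square = refl
    ... | null = contradiction (χ≡null⇒ χta) (*-nonzero (nonzero χt≡nonsquare) (nonzero χa≡nonsquare))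
      where
      nonzero : ∀ {x} → χ x ≡ nonsquare → x ≢ 0F
      nonzero χx≡nonsquare x≡0 = contradiction (trans (sym χx≡nonsquare) (χ-null x≡0)) λ ()
    ... | nonsquare = contradiction
      (trans (sym (cong₂ (λ u v → (u == nonsquare) ∧ not (v == square)) χta χa≡nonsquare))
             (Count≡0⇒false _ A∧nonsquare≡0 a)) λ ()
      where
      open ≡-Reasoning
      t≢0 : t ≢ 0F
      t≢0 t≡0 = contradiction (trans (sym χt≡nonsquare) (χ-null t≡0)) λ ()
      A : Carrier → Bool
      A x = χ (t *F x) == nonsquare
      squares⊆A : ∀ x → A x ∧ (χ x == square) ≡ (χ x == square)
      squares⊆A x with χ x in χx
      ... | null = ∧-zeroʳ (A x)
      ... | nonsquare = ∧-zeroʳ (A x)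
      ... | square = cong (λ c → (c == nonsquare) ∧ true)
                          (trans (cong χ (*-comm t x)) (trans (χ-square-* t χx) χt≡nonsquare))
      #A : Count A ≡ n
      #A = trans (Count-bijection (t *F_) (t ⁻¹ *F_) (⁻¹-cancelˡ t≢0) (⁻¹-cancelʳ t≢0) (λ x → χ x == nonsquare))
                 #nonsquares
      A∧nonsquare≡0 : Count (λ x → A x ∧ not (χ x == square)) ≡ 0
      A∧nonsquare≡0 = ℕ.+-cancelˡ-≡ n _ _ (begin
        n + Count (λ x → A x ∧ not (χ x == square))
          ≡⟨ cong (_+ Count (λ x → A x ∧ not (χ x == square))) (trans (Count-cong squares⊆A) #squares) ⟨
        Count (λ x → A x ∧ (χ x == square)) + Count (λ x → A x ∧ not (χ x == square))
          ≡⟨ Count-split A (λ x → χ x == square) ⟨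
        Count A       ≡⟨ #A ⟩
        n             ≡⟨ ℕ.+-identityʳ n ⟨
        n + 0         ∎)

    χ-* : ∀ a b → χ (a *F b) ≡ χ a · χ b
    χ-* a b with χ a in χa | χ b in χb
    ... | null | _ = χ-null (trans (cong (_*F b) (χ≡null⇒ χa)) (zeroˡ b))
    ... | square | _ = trans (χ-square-* b χa) χb
    ... | nonsquare | null = χ-null (trans (cong (a *F_) (χ≡null⇒ χb)) (zeroʳ a))
    ... | nonsquare | square = trans (cong χ (*-comm a b)) (trans (χ-square-* a χb) χa)
    ... | nonsquare | nonsquare = χ-nonsquare-* χa χb

  module OneModFour (m : ℕ) (q≡1+4m : q ≡ suc (2 * (2 * m))) where

    open OddOrder (2 * m) q≡1+4m public

    -- Otherwise x ↦ x⁻¹ would be an involution of the 2m squares fixing only 1.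
    χ-−1 : χ (-F 1F) ≡ square
    χ-−1 with χ (-F 1F) in χ−1
    ... | square = refl
    ... | null = contradiction (trans (sym (-‿involutive 1F)) (trans (cong -F_ (χ≡null⇒ χ−1)) -0#≈0#)) 1≢0
    ... | nonsquare with Count-involution _⁻¹ ⁻¹-involutive (λ x → χ x == square)
                                           (λ x → cong (_== square) (χ-⁻¹ x))
    ... | k , squares≡fixed+2k = contradiction 2m≡1+2k (ℕ.even≢odd m k)
      where
      open ≡-Reasoning
      fixed-is-1 : ∀ x → ((χ x == square) ∧ does (x ⁻¹ ≟ x)) ≡ true → x ≡ 1F
      fixed-is-1 x fixed with χ x in χx | does (x ⁻¹ ≟ x) in x⁻¹≟x
      fixed-is-1 x () | null | _
      fixed-is-1 x () | nonsquare | _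
      fixed-is-1 x () | square | false
      ... | square | true =
        [ (λ x≡1 → x≡1) , (λ x≡−1 → contradiction (trans (sym χx) (trans (cong χ x≡−1) χ−1)) λ ()) ]′
        (x*x≡y*y⇒x≡±y x 1F xx≡11)
        where
        x≢0 : x ≢ 0F
        x≢0 x≡0 = contradiction (trans (sym χx) (χ-null x≡0)) λ ()
        xx≡11 : x *F x ≡ 1F *F 1F
        xx≡11 = trans (cong (x *F_) (sym (dec-witness (x ⁻¹ ≟ x) x⁻¹≟x)))
                      (trans (⁻¹-inverseʳ x≢0) (sym (*-identityˡ 1F)))
      #fixed : Count (λ x → (χ x == square) ∧ does (x ⁻¹ ≟ x)) ≡ 1
      #fixed = Count-single _ 1F (cong₂ _∧_ (cong (_== square) χ-1) (dec-true (1F ⁻¹ ≟ 1F) 1⁻¹≡1))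
                            fixed-is-1
      2m≡1+2k : 2 * m ≡ suc (2 * k)
      2m≡1+2k = begin
        2 * m                                                          ≡⟨ #squares ⟨
        Count (λ x → χ x == square)                                    ≡⟨ squares≡fixed+2k ⟩
        Count (λ x → (χ x == square) ∧ does (x ⁻¹ ≟ x)) + 2 * k        ≡⟨ cong (_+ 2 * k) #fixed ⟩
        suc (2 * k)                                                    ∎

module CyclotomicNumbers {q : ℕ} (F : FiniteField q) (m : ℕ) (q≡1+4m : q ≡ suc (2 * (2 * m))) where

  open Counting
  open FiniteFieldFacts F
  open QuadraticCharacter F
  open OneModFour m q≡1+4m
  open import Data.Bool using (Bool; false; _∧_; not)
  open import Data.Bool.Properties using (∧-comm; ∧-zeroʳ; ∧-identityʳ)
  open import Data.Nat using (_+_)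
  import Data.Nat.Properties as ℕ
  open import Relation.Binary.PropositionalEquality
  open import Relation.Nullary using (contradiction)
  open import Data.Nat.Tactic.RingSolver using (solve-∀)

  χ-neg : ∀ a → χ (-F a) ≡ χ a
  χ-neg a = trans (cong χ (sym (-1*x≈-x a))) (trans (χ-* (-F 1F) a) (cong (_· χ a) χ-−1))

  χ-sub-comm : ∀ a b → χ (a -F b) ≡ χ (b -F a)
  χ-sub-comm a b = trans (sym (χ-neg (a -F b))) (cong χ (-[x-y]≡y-x a b))

  Count-translate : ∀ u (f : Class → Bool) → Count (λ z → f (χ (u -F z))) ≡ Count (λ w → f (χ w))
  Count-translate u f = Count-bijection (λ z → u -F z) (λ z → u -F z) u-[u-z]≡z u-[u-z]≡z (λ w → f (χ w))
    where
    u-[u-z]≡z : ∀ z → u -F (u -F z) ≡ z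
    u-[u-z]≡z z = trans (cong (u +F_) (-[x-y]≡y-x u z)) (x+[y-x]≡y u z)

  -- Substitute z = v + (u - v) w.
  Count-affine : ∀ {u v} → u ≢ v → (φ : Class → Class → Bool) →
    Count (λ z → φ (χ (u -F z)) (χ (v -F z)))
      ≡ Count (λ w → φ (χ (u -F v) · χ (w -F 1F)) (χ (u -F v) · χ w))
  Count-affine {u} {v} u≢v φ = sym (trans (Count-cong (λ w → cong₂ φ (χ[u-σw] w) (χ[v-σw] w)))
                                         (Count-bijection σ τ τσ στ (λ z → φ (χ (u -F z)) (χ (v -F z)))))
    where
    d : Carrier
    d = u -F v
    d≢0 : d ≢ 0F
    d≢0 d≡0 = u≢v (x-y≡0⇒x≡y u v d≡0)
    σ τ : Carrier → Carrier
    σ w = v +F (d *F w)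
    τ z = (z -F v) *F d ⁻¹
    τσ : ∀ w → τ (σ w) ≡ w
    τσ w = trans (cong (_*F d ⁻¹) ([x+y]-x≡y v (d *F w)))
                 (trans (*-comm (d *F w) (d ⁻¹)) (⁻¹-cancelˡ d≢0 w))
    στ : ∀ z → σ (τ z) ≡ z
    στ z = trans (cong (λ y → v +F (d *F y)) (*-comm (z -F v) (d ⁻¹)))
                 (trans (cong (v +F_) (⁻¹-cancelʳ d≢0 (z -F v))) (x+[y-x]≡y v z))
    χ[u-σw] : ∀ w → χ d · χ (w -F 1F) ≡ χ (u -F σ w)
    χ[u-σw] w = sym (begin
      χ (u -F (v +F (d *F w)))      ≡⟨ cong χ (x-[y+z]≡x-y-z u v (d *F w)) ⟩
      χ (d -F (d *F w))             ≡⟨ cong χ (x*-[y-1]≡x-xy d w) ⟨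
      χ (d *F (-F (w -F 1F)))       ≡⟨ χ-* d _ ⟩
      χ d · χ (-F (w -F 1F))        ≡⟨ cong (χ d ·_) (χ-neg (w -F 1F)) ⟩
      χ d · χ (w -F 1F)             ∎)
      where open ≡-Reasoning
    χ[v-σw] : ∀ w → χ d · χ w ≡ χ (v -F σ w)
    χ[v-σw] w = sym (begin
      χ (v -F (v +F (d *F w)))      ≡⟨ cong χ (x-[x+y]≡-y v (d *F w)) ⟩
      χ (-F (d *F w))               ≡⟨ χ-neg (d *F w) ⟩
      χ (d *F w)                    ≡⟨ χ-* d w ⟩
      χ d · χ w                     ∎)
      where open ≡-Reasoning

  cyclotomic : Class → Class → ℕ
  cyclotomic α β = Count (λ w → (χ (w -F 1F) == α) ∧ (χ w == β))

  χ≡nonsquare⇒χ[x-1]≢null : ∀ {w} → χ w ≡ nonsquare → χ (w -F 1F) ≢ null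
  χ≡nonsquare⇒χ[x-1]≢null {w} χw≡nonsquare χ[w-1]≡null =
    contradiction (trans (sym χw≡nonsquare) (trans (cong χ (x-y≡0⇒x≡y w 1F (χ≡null⇒ χ[w-1]≡null))) χ-1))
                  λ ()

  -- Substitute w ↦ w⁻¹, using w⁻¹ - 1 = w⁻¹ (1 - w).
  cyclotomic-SN≡NN : cyclotomic square nonsquare ≡ cyclotomic nonsquare nonsquare
  cyclotomic-SN≡NN =
    trans (sym (Count-bijection _⁻¹ _⁻¹ ⁻¹-involutive ⁻¹-involutive cell)) (Count-cong inverted)
    where
    cell : Carrier → Bool
    cell w = (χ (w -F 1F) == square) ∧ (χ w == nonsquare)
    nonsquare·c==square : ∀ c → (nonsquare · c == square) ≡ (c == nonsquare)
    nonsquare·c==square null = refl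
    nonsquare·c==square square = refl
    nonsquare·c==square nonsquare = refl
    inverted : ∀ w → cell (w ⁻¹) ≡ (χ (w -F 1F) == nonsquare) ∧ (χ w == nonsquare)
    inverted w = trans (cong ((χ (w ⁻¹ -F 1F) == square) ∧_) (cong (_== nonsquare) (χ-⁻¹ w)))
                       (∧-cong-if (χ w == nonsquare) (λ χw==nonsquare → χ[w⁻¹-1] (==-sound χw==nonsquare)))
      where
      χ[w⁻¹-1] : χ w ≡ nonsquare → (χ (w ⁻¹ -F 1F) == square) ≡ (χ (w -F 1F) == nonsquare)
      χ[w⁻¹-1] χw≡nonsquare = begin
        χ (w ⁻¹ -F 1F) == square
          ≡⟨ cong (λ x → χ (w ⁻¹ -F x) == square) (⁻¹-inverseˡ w≢0) ⟨
        χ (w ⁻¹ -F (w ⁻¹ *F w)) == square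
          ≡⟨ cong (λ x → χ x == square) (x*-[y-1]≡x-xy (w ⁻¹) w) ⟨
        χ (w ⁻¹ *F (-F (w -F 1F))) == square
          ≡⟨ cong (_== square) (χ-* (w ⁻¹) _) ⟩
        χ (w ⁻¹) · χ (-F (w -F 1F)) == square
          ≡⟨ cong₂ (λ a b → a · b == square) (trans (χ-⁻¹ w) χw≡nonsquare) (χ-neg (w -F 1F)) ⟩
        nonsquare · χ (w -F 1F) == square
          ≡⟨ nonsquare·c==square (χ (w -F 1F)) ⟩
        χ (w -F 1F) == nonsquare ∎
        where
        open ≡-Reasoning
        w≢0 : w ≢ 0F
        w≢0 w≡0 = contradiction (trans (sym χw≡nonsquare) (χ-null w≡0)) λ ()

  cyclotomic-SN+NN : cyclotomic square nonsquare + cyclotomic nonsquare nonsquare ≡ 2 * m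
  cyclotomic-SN+NN = begin
    cyclotomic square nonsquare + cyclotomic nonsquare nonsquare
      ≡⟨ cong₂ _+_ (Count-cong (λ w → ∧-comm (χ (w -F 1F) == square) (χ w == nonsquare))) (Count-cong rest) ⟩
    Count (λ w → (χ w == nonsquare) ∧ (χ (w -F 1F) == square))
      + Count (λ w → (χ w == nonsquare) ∧ not (χ (w -F 1F) == square))
      ≡⟨ Count-split (λ w → χ w == nonsquare) (λ w → χ (w -F 1F) == square) ⟨
    Count (λ w → χ w == nonsquare)
      ≡⟨ #nonsquares ⟩
    2 * m ∎
    where
    open ≡-Reasoning
    not-square : ∀ c → c ≢ null → (c == nonsquare) ≡ not (c == square)
    not-square null c≢null = contradiction refl c≢null
    not-square square _ = refl
    not-square nonsquare _ = refl
    rest : ∀ w → (χ (w -F 1F) == nonsquare) ∧ (χ w == nonsquare)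
               ≡ (χ w == nonsquare) ∧ not (χ (w -F 1F) == square)
    rest w = trans (∧-cong-if (χ w == nonsquare) (λ χw==nonsquare →
                     not-square (χ (w -F 1F)) (χ≡nonsquare⇒χ[x-1]≢null (==-sound χw==nonsquare))))
                   (∧-comm (not (χ (w -F 1F) == square)) (χ w == nonsquare))

  -- Substitute w ↦ 1 - w.
  cyclotomic-NS≡SN : cyclotomic nonsquare square ≡ cyclotomic square nonsquare
  cyclotomic-NS≡SN =
    trans (sym (Count-bijection σ σ σσ σσ (λ w → (χ (w -F 1F) == nonsquare) ∧ (χ w == square))))
          (Count-cong reflected)
    where
    σ : Carrier → Carrier
    σ w = 1F -F w
    σσ : ∀ w → σ (σ w) ≡ w
    σσ w = trans (cong (1F +F_) (-[x-y]≡y-x 1F w)) (x+[y-x]≡y 1F w)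
    reflected : ∀ w → (χ (σ w -F 1F) == nonsquare) ∧ (χ (σ w) == square)
                    ≡ (χ (w -F 1F) == square) ∧ (χ w == nonsquare)
    reflected w = trans (cong₂ (λ a b → (a == nonsquare) ∧ (b == square))
                               (trans (cong χ ([x-y]-x≡-y 1F w)) (χ-neg w)) (χ-sub-comm 1F w))
                        (∧-comm (χ w == nonsquare) (χ (w -F 1F) == square))

  cyclotomic-SN : cyclotomic square nonsquare ≡ m
  cyclotomic-SN = ℕ.*-cancelˡ-≡ _ _ 2 (begin
    2 * cyclotomic square nonsquare
      ≡⟨ cong (cyclotomic square nonsquare +_) (ℕ.+-identityʳ _) ⟩
    cyclotomic square nonsquare + cyclotomic square nonsquare
      ≡⟨ cong (cyclotomic square nonsquare +_) cyclotomic-SN≡NN ⟩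
    cyclotomic square nonsquare + cyclotomic nonsquare nonsquare
      ≡⟨ cyclotomic-SN+NN ⟩
    2 * m ∎)
    where open ≡-Reasoning

  cyclotomic-NN : cyclotomic nonsquare nonsquare ≡ m
  cyclotomic-NN = trans (sym cyclotomic-SN≡NN) cyclotomic-SN

  cyclotomic-NS : cyclotomic nonsquare square ≡ m
  cyclotomic-NS = trans cyclotomic-NS≡SN cyclotomic-SN

  Count-χ : ∀ (f : Class → Bool) →
    Count (λ w → f (χ w)) ≡ bit (f null) + (bit (f square) + bit (f nonsquare)) * (2 * m)
  Count-χ f = trans (Count-through-class χ f)
    (trans (cong₂ (λ a b → bit (f null) * a + b) #null
                  (cong₂ (λ a b → bit (f square) * a + bit (f nonsquare) * b) #squares #nonsquares))
           (collect (bit (f null)) (bit (f square)) (bit (f nonsquare)) (2 * m)))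
    where
    collect : ∀ a b c k → a * 1 + (b * k + c * k) ≡ a + (b + c) * k
    collect = solve-∀

  #[x-1]-null : Count (λ w → χ (w -F 1F) == null) ≡ 1
  #[x-1]-null = Count-single _ 1F (cong (_== null) (χ-null (x-x≡0 1F)))
    (λ w χ[w-1]==null → x-y≡0⇒x≡y w 1F (χ≡null⇒ (==-sound χ[w-1]==null)))

  Count-pairs : ∀ (ψ : Class → Class → Bool) → ψ square square ≡ false →
    Count (λ w → ψ (χ (w -F 1F)) (χ w)) ≡
      bit (ψ square null) + bit (ψ null square)
        + (bit (ψ square nonsquare) + bit (ψ nonsquare square) + bit (ψ nonsquare nonsquare)) * m
  Count-pairs ψ ψSS≡false = begin
    Count (λ w → ψ (c₁ w) (c₂ w))
      ≡⟨ Sum-cong (λ w → cells (c₁ w) (c₂ w) (left-square w) (right-square w)) ⟩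
    Sum (λ w → t₁ w + (t₂ w + (t₃ w + (t₄ w + t₅ w))))
      ≡⟨ Sum-+ t₁ (λ w → t₂ w + (t₃ w + (t₄ w + t₅ w))) ⟩
    Sum t₁ + Sum (λ w → t₂ w + (t₃ w + (t₄ w + t₅ w)))
      ≡⟨ cong (Sum t₁ +_) (Sum-+ t₂ (λ w → t₃ w + (t₄ w + t₅ w))) ⟩
    Sum t₁ + (Sum t₂ + Sum (λ w → t₃ w + (t₄ w + t₅ w)))
      ≡⟨ cong (λ s → Sum t₁ + (Sum t₂ + s)) (Sum-+ t₃ (λ w → t₄ w + t₅ w)) ⟩
    Sum t₁ + (Sum t₂ + (Sum t₃ + Sum (λ w → t₄ w + t₅ w)))
      ≡⟨ cong (λ s → Sum t₁ + (Sum t₂ + (Sum t₃ + s))) (Sum-+ t₄ t₅) ⟩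
    Sum t₁ + (Sum t₂ + (Sum t₃ + (Sum t₄ + Sum t₅)))
      ≡⟨ cong₂ _+_ (value (λ w → c₂ w == null) #null)
         (cong₂ _+_ (value (λ w → c₁ w == null) #[x-1]-null)
         (cong₂ _+_ (value (λ w → (c₁ w == square) ∧ (c₂ w == nonsquare)) cyclotomic-SN)
         (cong₂ _+_ (value (λ w → (c₁ w == nonsquare) ∧ (c₂ w == square)) cyclotomic-NS)
                    (value (λ w → (c₁ w == nonsquare) ∧ (c₂ w == nonsquare)) cyclotomic-NN)))) ⟩
    bit (ψ square null) * 1 + (bit (ψ null square) * 1 + (bit (ψ square nonsquare) * m
      + (bit (ψ nonsquare square) * m + bit (ψ nonsquare nonsquare) * m)))
      ≡⟨ collect (bit (ψ square null)) (bit (ψ null square)) (bit (ψ square nonsquare))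
                 (bit (ψ nonsquare square)) (bit (ψ nonsquare nonsquare)) m ⟩
    bit (ψ square null) + bit (ψ null square)
      + (bit (ψ square nonsquare) + bit (ψ nonsquare square) + bit (ψ nonsquare nonsquare)) * m ∎
    where
    open ≡-Reasoning
    collect : ∀ a b c d e k → a * 1 + (b * 1 + (c * k + (d * k + e * k))) ≡ a + b + (c + d + e) * k
    collect = solve-∀
    c₁ c₂ : Carrier → Class
    c₁ w = χ (w -F 1F)
    c₂ w = χ w
    t₁ t₂ t₃ t₄ t₅ : Carrier → ℕ
    t₁ w = bit ((c₂ w == null) ∧ ψ square null)
    t₂ w = bit ((c₁ w == null) ∧ ψ null square)
    t₃ w = bit (((c₁ w == square) ∧ (c₂ w == nonsquare)) ∧ ψ square nonsquare)
    t₄ w = bit (((c₁ w == nonsquare) ∧ (c₂ w == square)) ∧ ψ nonsquare square)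
    t₅ w = bit (((c₁ w == nonsquare) ∧ (c₂ w == nonsquare)) ∧ ψ nonsquare nonsquare)
    value : ∀ (cell : Carrier → Bool) {b k} → Count cell ≡ k → Count (λ w → cell w ∧ b) ≡ bit b * k
    value cell {b} #cell = trans (Count-∧-const cell b) (cong (bit b *_) #cell)
    left-square : ∀ w → c₂ w ≡ null → c₁ w ≡ square
    left-square w χw≡null =
      trans (cong χ (trans (cong (_-F 1F) (χ≡null⇒ χw≡null)) (+-identityˡ (-F 1F)))) χ-−1
    right-square : ∀ w → c₁ w ≡ null → c₂ w ≡ square
    right-square w χ[w-1]≡null = trans (cong χ (x-y≡0⇒x≡y w 1F (χ≡null⇒ χ[w-1]≡null))) χ-1
    cells : ∀ c₁ c₂ → (c₂ ≡ null → c₁ ≡ square) → (c₁ ≡ null → c₂ ≡ square) →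
      bit (ψ c₁ c₂) ≡ bit ((c₂ == null) ∧ ψ square null) + (bit ((c₁ == null) ∧ ψ null square)
        + (bit (((c₁ == square) ∧ (c₂ == nonsquare)) ∧ ψ square nonsquare)
        + (bit (((c₁ == nonsquare) ∧ (c₂ == square)) ∧ ψ nonsquare square)
        + bit (((c₁ == nonsquare) ∧ (c₂ == nonsquare)) ∧ ψ nonsquare nonsquare))))
    cells null null _ r with () ← r refl
    cells null square _ _ = sym (ℕ.+-identityʳ _)
    cells null nonsquare _ r with () ← r refl
    cells square null _ _ = sym (ℕ.+-identityʳ _)
    cells square square _ _ = cong bit ψSS≡false
    cells square nonsquare _ _ = sym (ℕ.+-identityʳ _)
    cells nonsquare null l _ with () ← l refl
    cells nonsquare square _ _ = sym (ℕ.+-identityʳ _)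
    cells nonsquare nonsquare _ _ = refl

  Count-affine-cases : ∀ {u v} → u ≢ v → (φ : Class → Class → Bool) (R : ℕ → Set) →
    R (Count (λ w → φ (χ (w -F 1F)) (χ w))) →
    R (Count (λ w → φ (nonsquare · χ (w -F 1F)) (nonsquare · χ w))) →
    R (Count (λ z → φ (χ (u -F z)) (χ (v -F z))))
  Count-affine-cases {u} {v} u≢v φ R R-square R-nonsquare =
    subst R (sym (Count-affine u≢v φ))
            (twisted (χ (u -F v)) (χ-nonzero (λ d≡0 → u≢v (x-y≡0⇒x≡y u v d≡0))))
    where
    twisted : ∀ c → c ≢ null → R (Count (λ w → φ (c · χ (w -F 1F)) (c · χ w)))
    twisted null c≢null = contradiction refl c≢null
    twisted square _ = R-square
    twisted nonsquare _ = R-nonsquare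

module NeighbourhoodProfiles {q : ℕ} (F : FiniteField q) (m : ℕ) (q≡1+4m : q ≡ suc (2 * (2 * m))) where

  open Counting
  open FiniteFieldFacts F
  open QuadraticCharacter F
  open OneModFour m q≡1+4m
  open CyclotomicNumbers F m q≡1+4m
  open import Data.Bool using (Bool; true; false; not; _xor_)
  open import Data.Bool.Properties using (xor-comm; not-distribʳ-xor)
  open import Data.Nat using (_+_; _≤_)
  import Data.Nat.Properties as ℕ
  open import Relation.Binary.PropositionalEquality
  open import Relation.Nullary using (yes; no; contradiction)

  Count-pairs-≥ : ∀ (ψ : Class → Class → Bool) → ψ square square ≡ false → ∀ {b} →
    b ≤ bit (ψ square null) + bit (ψ null square)
          + (bit (ψ square nonsquare) + bit (ψ nonsquare square) + bit (ψ nonsquare nonsquare)) * m →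
    b ≤ Count (λ w → ψ (χ (w -F 1F)) (χ w))
  Count-pairs-≥ ψ ψSS≡false {b} = subst (b ≤_) (sym (Count-pairs ψ ψSS≡false))

  Count-χ-≥ : ∀ u (f : Class → Bool) → ∀ {b} →
    b ≤ bit (f null) + (bit (f square) + bit (f nonsquare)) * (2 * m) →
    b ≤ Count (λ z → f (χ (u -F z)))
  Count-χ-≥ u f {b} = subst (b ≤_) (sym (trans (Count-translate u f) (Count-χ f)))

  -- The vertex kinds of the extended graph: a Paley vertex, a vertex co u adjacent to u and to the
  -- non-neighbours of u, and an apex adjacent to every Paley vertex.
  data Kind : Set where
    paley co : Carrier → Kind
    apex : Kind

  profile : Kind → Carrier → Bool
  profile (paley u) z = not (χ (u -F z) == nonsquare)
  profile (co u) z = not (χ (u -F z) == square)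
  profile apex z = true

  2m≤Count-profile : ∀ k → 2 * m ≤ Count (profile k)
  2m≤Count-profile (paley u) = Count-χ-≥ u (λ c → not (c == nonsquare)) (ℕ.m≤n⇒m≤1+n (ℕ.m≤m+n (2 * m) 0))
  2m≤Count-profile (co u) = Count-χ-≥ u (λ c → not (c == square)) (ℕ.m≤n⇒m≤1+n (ℕ.m≤m+n (2 * m) 0))
  2m≤Count-profile apex =
    subst (2 * m ≤_) (sym (trans Count-all q≡1+4m)) (ℕ.m≤n⇒m≤1+n (ℕ.m≤m+n (2 * m) _))

  paley-paley-xor : ∀ {u v} → u ≢ v → 2 * m ≤ Count (λ z → profile (paley u) z xor profile (paley v) z)
  paley-paley-xor u≢v = Count-affine-cases u≢v φ (2 * m ≤_) (Count-pairs-≥ φ refl ℕ.≤-refl)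
    (Count-pairs-≥ (λ α β → φ (nonsquare · α) (nonsquare · β)) refl (ℕ.m≤n+m (2 * m) 2))
    where
    φ : Class → Class → Bool
    φ α β = not (α == nonsquare) xor not (β == nonsquare)

  co-co-xor : ∀ {u v} → u ≢ v → 2 * m ≤ Count (λ z → profile (co u) z xor profile (co v) z)
  co-co-xor u≢v = Count-affine-cases u≢v φ (2 * m ≤_) (Count-pairs-≥ φ refl (ℕ.m≤n+m (2 * m) 2))
    (Count-pairs-≥ (λ α β → φ (nonsquare · α) (nonsquare · β)) refl ℕ.≤-refl)
    where
    φ : Class → Class → Bool
    φ α β = not (α == square) xor not (β == square)

  paley-co-xor : ∀ u v → 2 * m ≤ Count (λ z → profile (paley u) z xor profile (co v) z)
  paley-co-xor u v with u ≟ v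
  ... | yes refl = Count-χ-≥ u (λ c → not (c == nonsquare) xor not (c == square)) (ℕ.m≤m+n (2 * m) _)
  ... | no u≢v = subst (2 * m ≤_)
    (sym (trans (Count-cong (λ z → sym (not-distribʳ-xor (profile (paley u) z) (χ (v -F z) == square)))) #¬X))
    (ℕ.m≤m+n (2 * m) 0)
    where
    open ≡-Reasoning
    -- The complement is counted instead: it avoids the class pair (square , square).
    φ : Class → Class → Bool
    φ α β = not (α == nonsquare) xor (β == square)
    X : Carrier → Bool
    X z = φ (χ (u -F z)) (χ (v -F z))
    #X : Count X ≡ suc (2 * m)
    #X = Count-affine-cases u≢v φ (_≡ suc (2 * m)) (Count-pairs φ refl)
      (Count-pairs (λ α β → φ (nonsquare · α) (nonsquare · β)) refl)
    #¬X : Count (λ z → not (X z)) ≡ 2 * m + 0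
    #¬X = ℕ.+-cancelˡ-≡ (suc (2 * m)) _ _ (begin
      suc (2 * m) + Count (λ z → not (X z))   ≡⟨ cong (_+ Count (λ z → not (X z))) #X ⟨
      Count X + Count (λ z → not (X z))       ≡⟨ Count-complement X ⟩
      q                                       ≡⟨ q≡1+4m ⟩
      suc (2 * m) + (2 * m + 0)               ∎)

  paley-apex-xor : ∀ u → 2 * m ≤ Count (λ z → profile (paley u) z xor profile apex z)
  paley-apex-xor u = Count-χ-≥ u (λ c → not (c == nonsquare) xor true) (ℕ.m≤m+n (2 * m) 0)

  co-apex-xor : ∀ u → 2 * m ≤ Count (λ z → profile (co u) z xor profile apex z)
  co-apex-xor u = Count-χ-≥ u (λ c → not (c == square) xor true) (ℕ.m≤m+n (2 * m) 0)

  flipped : ∀ (P Q : Carrier → Bool) {b} →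
    b ≤ Count (λ z → P z xor Q z) → b ≤ Count (λ z → Q z xor P z)
  flipped P Q {b} = subst (b ≤_) (Count-cong (λ z → xor-comm (P z) (Q z)))

  2m≤Count-profile-xor : ∀ k k′ → k ≢ k′ → 2 * m ≤ Count (λ z → profile k z xor profile k′ z)
  2m≤Count-profile-xor (paley u) (paley v) k≢k′ = paley-paley-xor (λ u≡v → k≢k′ (cong paley u≡v))
  2m≤Count-profile-xor (paley u) (co v) _ = paley-co-xor u v
  2m≤Count-profile-xor (paley u) apex _ = paley-apex-xor u
  2m≤Count-profile-xor (co u) (paley v) _ = flipped (profile (paley v)) (profile (co u)) (paley-co-xor v u)
  2m≤Count-profile-xor (co u) (co v) k≢k′ = co-co-xor (λ u≡v → k≢k′ (cong co u≡v))
  2m≤Count-profile-xor (co u) apex _ = co-apex-xor u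
  2m≤Count-profile-xor apex (paley v) _ = flipped (profile (paley v)) (profile apex) (paley-apex-xor v)
  2m≤Count-profile-xor apex (co v) _ = flipped (profile (co v)) (profile apex) (co-apex-xor v)
  2m≤Count-profile-xor apex apex k≢k′ = contradiction refl k≢k′

module PaleyGraphs {q : ℕ} (F : FiniteField q) (m : ℕ) (q≡1+4m : q ≡ suc (2 * (2 * m))) where

  open Counting
  open IdentifyingCodes
  open FiniteFieldFacts F
  open QuadraticCharacter F
  open OneModFour m q≡1+4m
  open CyclotomicNumbers F m q≡1+4m
  open NeighbourhoodProfiles F m q≡1+4m
  open import Data.Bool using (Bool; true; false; _∨_; _xor_)
  open import Data.Bool.Properties using (∨-zeroʳ)
  open import Data.Fin using (Fin; toℕ; fromℕ<; _↑ˡ_; _↑ʳ_; splitAt; join)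
  import Data.Fin.Properties as Fin
  open import Data.Nat using (_+_; _≤_; _<_)
  import Data.Nat.Properties as ℕ
  open import Data.Product using (_,_; proj₁)
  open import Data.Sum using (inj₁; inj₂; [_,_]′)
  open import Function.Bundles using (_⇔_; mk⇔; Equivalence)
  open import Relation.Binary.PropositionalEquality
  open import Relation.Nullary using (¬_; Dec; yes; no; contradiction)
  open import Relation.Nullary.Decidable using (dec-true; dec-false; does-⇔)
  open import Data.Nat.Tactic.RingSolver using (solve-∀)

  χ==square⇔IsNonzeroSquare : ∀ d → (χ d == square) ≡ true ⇔ IsNonzeroSquare d
  χ==square⇔IsNonzeroSquare d = mk⇔ (λ h → Equivalence.to χ≡square⇔IsNonzeroSquare (==-sound h))
    (λ sq → cong (_== square) (Equivalence.from χ≡square⇔IsNonzeroSquare sq))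

  paley-adjacent : Fin q → Fin q → Bool
  paley-adjacent i j = χ (to i -F to j) == square

  closed-paley : ∀ (i j : Fin q) → closed paley-adjacent i j ≡ profile (paley (to i)) (to j)
  closed-paley i j with χ (to i -F to j) in χd
  ... | null = cong (_∨ false) (dec-true (j Fin.≟ i) (sym (to-injective (x-y≡0⇒x≡y _ _ (χ≡null⇒ χd)))))
  ... | square = ∨-zeroʳ _
  ... | nonsquare = cong (_∨ false)
    (dec-false (j Fin.≟ i) (λ { refl → contradiction (trans (sym χd) (χ-null (x-x≡0 (to i)))) λ () }))

  paley-simple : IsSimple (PaleyAdj F)
  paley-simple = (λ {i} {j} Pij → Equivalence.to χ≡square⇔IsNonzeroSquare
                     (trans (χ-sub-comm (to j) (to i)) (Equivalence.from χ≡square⇔IsNonzeroSquare Pij)))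
               , (λ {i} Pii → proj₁ Pii (x-x≡0 (to i)))

  paley-injective : ∀ {u v} → paley u ≡ paley v → u ≡ v
  paley-injective refl = refl

  paley-in-Gr : InGrAdj q (suc (suc (2 * m))) (PaleyAdj F)
  paley-in-Gr C ∣C∣≡ =
    large⇒identifying (PaleyAdj F) paley-adjacent (λ i j → χ==square⇔IsNonzeroSquare _) (2 * m)
    (λ i → subst (2 * m ≤_) (sym (count-cong (closed-paley i))) (2m≤Count-profile (paley (to i))))
    (λ i j i≢j → subst (2 * m ≤_) (sym (count-cong (λ z → cong₂ _xor_ (closed-paley i z) (closed-paley j z))))
       (2m≤Count-profile-xor (paley (to i)) (paley (to j)) (λ e → i≢j (to-injective (paley-injective e)))))
    C (subst (λ s → q < s + 2 * m) (sym ∣C∣≡) large)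
    where
    large : q < suc (suc (2 * m)) + 2 * m
    large = subst (_< suc (suc (2 * m)) + 2 * m) (sym q≡1+4m) (ℕ.≤-reflexive (arith m))
      where
      arith : ∀ m → suc (suc (2 * (2 * m))) ≡ suc (suc (2 * m)) + 2 * m
      arith = solve-∀

  module Extension (i : ℕ) (i≤q+1 : i ≤ q + 1) where

    -- The extra vertex j copies the Paley vertex with index j when j < q; the extra vertex q,
    -- present only when i = q + 1, is the apex.
    extra′ : (j : Fin i) → Dec (toℕ j < q) → Kind
    extra′ j (yes j<q) = co (to (fromℕ< j<q))
    extra′ j (no _) = apex

    extra : Fin i → Kind
    extra j = extra′ j (toℕ j ℕ.<? q)

    toℕ≮q⇒≡q : ∀ (j : Fin i) → ¬ (toℕ j < q) → toℕ j ≡ q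
    toℕ≮q⇒≡q j j≮q =
      ℕ.≤-antisym (ℕ.m<1+n⇒m≤n (ℕ.<-≤-trans (Fin.toℕ<n j) (subst (i ≤_) (ℕ.+-comm q 1) i≤q+1))) (ℕ.≮⇒≥ j≮q)

    extra′-injective : ∀ j j′ d d′ → extra′ j d ≡ extra′ j′ d′ → j ≡ j′
    extra′-injective j j′ (yes j<q) (yes j′<q) e =
      Fin.toℕ-injective (Fin.fromℕ<-injective (toℕ j) (toℕ j′) j<q j′<q (to-injective (co-injective e)))
      where
      co-injective : ∀ {u v} → co u ≡ co v → u ≡ v
      co-injective refl = refl
    extra′-injective j j′ (no j≮q) (no j′≮q) _ =
      Fin.toℕ-injective (trans (toℕ≮q⇒≡q j j≮q) (sym (toℕ≮q⇒≡q j′ j′≮q)))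

    extra′≢paley : ∀ j d u → extra′ j d ≢ paley u
    extra′≢paley j (yes _) u ()
    extra′≢paley j (no _) u ()

    kind : Fin (q + i) → Kind
    kind v = [ (λ a → paley (to a)) , extra ]′ (splitAt q v)

    data Side : Fin (q + i) → Set where
      paley-side : ∀ a → Side (a ↑ˡ i)
      extra-side : ∀ j → Side (q ↑ʳ j)

    side : ∀ v → Side v
    side v = subst Side (Fin.join-splitAt q i v) (from-split (splitAt q v))
      where
      from-split : ∀ s → Side (join q i s)
      from-split (inj₁ a) = paley-side a
      from-split (inj₂ j) = extra-side j

    kind-↑ˡ : ∀ a → kind (a ↑ˡ i) ≡ paley (to a)
    kind-↑ˡ a rewrite Fin.splitAt-↑ˡ q a i = refl

    kind-↑ʳ : ∀ j → kind (q ↑ʳ j) ≡ extra j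
    kind-↑ʳ j rewrite Fin.splitAt-↑ʳ q i j = refl

    kind-injective : ∀ x y → kind x ≡ kind y → x ≡ y
    kind-injective x y e with side x | side y
    ... | paley-side a | paley-side b =
      cong (_↑ˡ i) (to-injective (paley-injective (trans (sym (kind-↑ˡ a)) (trans e (kind-↑ˡ b)))))
    ... | paley-side a | extra-side j =
      contradiction (trans (sym (kind-↑ʳ j)) (trans (sym e) (kind-↑ˡ a))) (extra′≢paley j _ (to a))
    ... | extra-side j | paley-side a =
      contradiction (trans (sym (kind-↑ʳ j)) (trans e (kind-↑ˡ a))) (extra′≢paley j _ (to a))
    ... | extra-side j | extra-side j′ =
      cong (q ↑ʳ_) (extra′-injective j j′ _ _ (trans (sym (kind-↑ʳ j)) (trans e (kind-↑ʳ j′))))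

    adjacent : Kind → Kind → Bool
    adjacent (paley u) (paley v) = χ (u -F v) == square
    adjacent (paley u) (co c) = profile (co c) u
    adjacent (co c) (paley u) = profile (co c) u
    adjacent (paley u) apex = true
    adjacent apex (paley u) = true
    adjacent _ _ = false

    adjacent-sym : ∀ k k′ → adjacent k k′ ≡ adjacent k′ k
    adjacent-sym (paley u) (paley v) = cong (_== square) (χ-sub-comm u v)
    adjacent-sym (paley u) (co c) = refl
    adjacent-sym (paley u) apex = refl
    adjacent-sym (co c) (paley u) = refl
    adjacent-sym (co c) (co c′) = refl
    adjacent-sym (co c) apex = refl
    adjacent-sym apex (paley u) = refl
    adjacent-sym apex (co c) = refl
    adjacent-sym apex apex = refl

    adjacent-irrefl : ∀ k → adjacent k k ≡ false
    adjacent-irrefl (paley u) = cong (_== square) (χ-null (x-x≡0 u))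
    adjacent-irrefl (co c) = refl
    adjacent-irrefl apex = refl

    adjacency : Fin (q + i) → Fin (q + i) → Bool
    adjacency x y = adjacent (kind x) (kind y)

    extension : Graph (q + i)
    extension = record
      { Adj = λ x y → adjacency x y ≡ true
      ; simple = (λ {x} {y} xy → trans (adjacent-sym (kind y) (kind x)) xy)
               , (λ {x} xx → contradiction (trans (sym xx) (adjacent-irrefl (kind x))) λ ())
      }

    closed-↑ˡ : ∀ x a → closed adjacency x (a ↑ˡ i) ≡ profile (kind x) (to a)
    closed-↑ˡ x a with side x
    ... | paley-side b rewrite kind-↑ˡ a | kind-↑ˡ b =
      trans (cong (_∨ (χ (to b -F to a) == square))
                  (does-⇔ (mk⇔ (Fin.↑ˡ-injective i a b) (cong (_↑ˡ i))) (a ↑ˡ i Fin.≟ b ↑ˡ i) (a Fin.≟ b)))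
            (closed-paley b a)
    ... | extra-side j rewrite kind-↑ˡ a | kind-↑ʳ j =
      trans (cong (_∨ adjacent (extra j) (paley (to a))) (dec-false (a ↑ˡ i Fin.≟ q ↑ʳ j) ↑ˡ≢↑ʳ))
            (extra′-paley j (toℕ j ℕ.<? q))
      where
      extra′-paley : ∀ j d → adjacent (extra′ j d) (paley (to a)) ≡ profile (extra′ j d) (to a)
      extra′-paley j (yes _) = refl
      extra′-paley j (no _) = refl
      ↑ˡ≢↑ʳ : a ↑ˡ i ≢ q ↑ʳ j
      ↑ˡ≢↑ʳ e with () ← trans (sym (Fin.splitAt-↑ˡ q a i))
                              (trans (cong (splitAt q) e) (Fin.splitAt-↑ʳ q i j))

    extension-in-Gr : InGr (q + i) (suc (suc (2 * m)) + i) extension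
    extension-in-Gr C ∣C∣≡ =
      large⇒identifying (Graph.Adj extension) adjacency (λ _ _ → mk⇔ (λ a → a) (λ a → a)) (2 * m)
        dominating separating C (subst (λ s → q + i < s + 2 * m) (sym ∣C∣≡) large)
      where
      on-paley-part : ∀ (p : Fin (q + i) → Bool) {b} → b ≤ count (λ a → p (a ↑ˡ i)) → b ≤ count p
      on-paley-part p bound = ℕ.≤-trans bound (count-↑ˡ i p)
      dominating : ∀ x → 2 * m ≤ count (closed adjacency x)
      dominating x = on-paley-part (closed adjacency x)
        (subst (2 * m ≤_) (sym (count-cong (closed-↑ˡ x))) (2m≤Count-profile (kind x)))
      separating : ∀ x y → x ≢ y → 2 * m ≤ count (λ z → closed adjacency x z xor closed adjacency y z)
      separating x y x≢y = on-paley-part (λ z → closed adjacency x z xor closed adjacency y z)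
        (subst (2 * m ≤_) (sym (count-cong (λ a → cong₂ _xor_ (closed-↑ˡ x a) (closed-↑ˡ y a))))
               (2m≤Count-profile-xor (kind x) (kind y) (λ e → x≢y (kind-injective x y e))))
      large : q + i < suc (suc (2 * m)) + i + 2 * m
      large = subst (λ s → s + i < suc (suc (2 * m)) + i + 2 * m) (sym q≡1+4m) (ℕ.≤-reflexive (arith m i))
        where
        arith : ∀ m i → suc (suc (2 * (2 * m)) + i) ≡ suc (suc (2 * m)) + i + 2 * m
        arith = solve-∀

theorem27 : (q : ℕ) (F : FiniteField q) → q % 4 ≡ 1 →
    (IsSimple (PaleyAdj F) × InGrAdj q ((q + 3) / 2) (PaleyAdj F))
    × (∀ (i : ℕ) → i ≤ q + 1 → Σ (Graph (q + i)) (λ G → InGr (q + i) ((q + 3) / 2 + i) G))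
theorem27 q F q%4≡1 =
  (paley-simple , subst (λ k → InGrAdj q k (PaleyAdj F)) (sym k≡) paley-in-Gr)
  , λ i i≤q+1 → let open Extension i i≤q+1 in
      extension , subst (λ k → InGr (q + i) (k + i) extension) (sym k≡) extension-in-Gr
  where
  m : ℕ
  m = q / 4
  q≡1+m*4 : q ≡ 1 + m * 4
  q≡1+m*4 = trans (m≡m%n+[m/n]*n q 4) (cong (_+ m * 4) q%4≡1)
  q≡1+4m : q ≡ suc (2 * (2 * m))
  q≡1+4m = trans q≡1+m*4 (arith m)
    where
    arith : ∀ m → 1 + m * 4 ≡ suc (2 * (2 * m))
    arith = solve-∀
  k≡ : (q + 3) / 2 ≡ suc (suc (2 * m))
  k≡ = trans (cong (λ n → (n + 3) / 2) q≡1+m*4)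
             (trans (cong (_/ 2) (arith m)) (m*n/n≡m (suc (suc (2 * m))) 2))
    where
    arith : ∀ m → 1 + m * 4 + 3 ≡ suc (suc (2 * m)) * 2
    arith = solve-∀
  open PaleyGraphs F m q≡1+4m
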